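{- Let $G$ be a graph such that no connected component of $\mathcal{I}^1_{\mathrm{AR}}(G)$ is an even cycle. Then the partition $\{V_1,\dots,V_{\alpha(G)}\}$ of $V(\mathcal{I}^1_{\mathrm{AR}}(G))$, where $V_i$ is the set of independent sets of $G$ of size $i$, is the unique layering of $\mathcal{I}^1_{\mathrm{AR}}(G)$.
   Context: $\alpha(G)$ is the independence number of $G$. $\mathcal{I}^1_{\mathrm{AR}}(G)$ is the graph whose vertices are the non-empty independent sets of $G$, two being adjacent iff one is obtained from the other by adding or removing a single vertex. A layering of a graph $X$ is a partition of $V(X)$ into layers $V_1,\dots,V_p$ such that: (1) each layer is an independent set of $X$; (2) every neighbour of a vertex in $V_i$ lies in $V_{i-1}\cup V_{i+1}$; (3) for $2\leq i\leq p$, each vertex of $V_i$ has exactly $i$ neighbours in $V_{i-1}$; (4) for $1\leq i\leq p$, any two vertices of $V_i$ have at most one common neighbour in $V_{i-1}$ and at most one in $V_{i+1}$. -}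

module Defs where

open import Data.Nat using (ℕ; zero; suc; _+_; _∸_; _≤_; _≡ᵇ_; _⊔_)
open import Data.Nat.Divisibility using (_∣_)
open import Data.Bool using (Bool; true; false; _∧_; _xor_; not; T)
open import Data.Bool.ListAction using (and; or)
open import Data.Fin using (Fin; toℕ)
open import Data.Fin.Subset using (Subset; ∣_∣; inside; outside)
open import Data.Vec using (Vec; []; _∷_; lookup; zipWith)
open import Data.List using (List; []; _∷_; map; _++_; filterᵇ; length; allFin; foldr)
open import Data.List.Membership.Propositional using (_∈_)
open import Data.Product using (Σ; _×_; ∃)
open import Data.Sum using (_⊎_)
open import Relation.Binary.PropositionalEquality using (_≡_; _≢_)
open import Function.Bundles using (_⇔_)

record SimpleGraph (n : ℕ) : Set where
  field
    adj   : Fin n → Fin n → Bool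
    sym   : ∀ i j → adj i j ≡ adj j i
    irrefl : ∀ i → adj i i ≡ false
open SimpleGraph public

allSubsets : (n : ℕ) → List (Subset n)
allSubsets zero    = [] ∷ []
allSubsets (suc n) = map (inside ∷_) (allSubsets n) ++ map (outside ∷_) (allSubsets n)

isIndependent : ∀ {n} → SimpleGraph n → Subset n → Bool
isIndependent {n} G S =
  and (map (λ i → and (map (λ j → not (lookup S i ∧ lookup S j ∧ adj G i j)) (allFin n))) (allFin n))

isNonempty : ∀ {n} → Subset n → Bool
isNonempty {n} S = or (map (λ i → lookup S i) (allFin n))

α : ∀ {n} → SimpleGraph n → ℕ
α {n} G = foldr (λ S m → ∣ S ∣ ⊔ m) 0 (filterᵇ (isIndependent G) (allSubsets n))

-- Finite graphs X given by a duplicate-free vertex list over a type V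
-- and a Boolean adjacency relation.

record FinGraph (V : Set) : Set where
  field
    verts : List V
    E     : V → V → Bool
open FinGraph public

countᵇ : {V : Set} → (V → Bool) → List V → ℕ
countᵇ p xs = length (filterᵇ p xs)

_△_ : ∀ {n} → Subset n → Subset n → Subset n
S △ T = zipWith _xor_ S T

IAR : ∀ {n} → SimpleGraph n → FinGraph (Subset n)
IAR {n} G = record
  { verts = filterᵇ (λ S → isIndependent G S ∧ isNonempty S) (allSubsets n)
  ; E     = λ S T → ∣ S △ T ∣ ≡ᵇ 1
  }

-- Layerings.  A partition of V(X) into p layers V₁,…,Vₚ is encoded by
-- the labelling f : V → ℕ with Vᵢ = { v ∈ V(X) | f v ≡ i }; every vertex
-- gets a label in [1,p] and every layer is non-empty.

record IsLayering {V : Set} (X : FinGraph V) (p : ℕ) (f : V → ℕ) : Set where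
  field
    label-range : ∀ v → v ∈ verts X → 1 ≤ f v × f v ≤ p
    layer-nonempty : ∀ i → 1 ≤ i → i ≤ p → Σ V (λ v → v ∈ verts X × f v ≡ i)
    layer-indep : ∀ u v → u ∈ verts X → v ∈ verts X → f u ≡ f v → E X u v ≡ false
    adjacent-layers : ∀ u v → u ∈ verts X → v ∈ verts X → E X u v ≡ true →
                      f v ≡ f u + 1 ⊎ f u ≡ f v + 1
    down-degree : ∀ v → v ∈ verts X → 2 ≤ f v →
                  countᵇ (λ u → E X v u ∧ (f u ≡ᵇ f v ∸ 1)) (verts X) ≡ f v
    -- (4) two distinct vertices of Vᵢ have at most one common neighbour
    --     in Vᵢ₋₁ and at most one in Vᵢ₊₁
    common-down : ∀ u v → u ∈ verts X → v ∈ verts X → u ≢ v → f u ≡ f v →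
                  countᵇ (λ w → E X u w ∧ E X v w ∧ (f w ≡ᵇ f u ∸ 1)) (verts X) ≤ 1
    common-up   : ∀ u v → u ∈ verts X → v ∈ verts X → u ≢ v → f u ≡ f v →
                  countᵇ (λ w → E X u w ∧ E X v w ∧ (f w ≡ᵇ f u + 1)) (verts X) ≤ 1

data Reach {V : Set} (X : FinGraph V) (u : V) : V → Set where
  here : Reach X u u
  step : ∀ {v w} → Reach X u v → w ∈ verts X → E X v w ≡ true → Reach X u w

CyclicSucc : (k : ℕ) → Fin k → Fin k → Set
CyclicSucc k i j = toℕ j ≡ suc (toℕ i) ⊎ (suc (toℕ i) ≡ k × toℕ j ≡ 0)

ComponentIsEvenCycle : {V : Set} → FinGraph V → V → Set
ComponentIsEvenCycle {V} X v =
  Σ ℕ λ k → (3 ≤ k) × (2 ∣ k) × Σ (Fin k → V) λ c →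
    (∀ i j → c i ≡ c j → i ≡ j) ×
    (∀ w → (Reach X v w ⇔ Σ (Fin k) λ j → c j ≡ w)) ×
    (∀ i j → (E X (c i) (c j) ≡ true ⇔
               (CyclicSucc k i j ⊎ CyclicSucc k j i)))

NoEvenCycleComponent : {V : Set} → FinGraph V → Set
NoEvenCycleComponent X = ∀ v → v ∈ verts X → ComponentIsEvenCycle X v → Data.Empty.⊥
  where import Data.Empty

{-# OPTIONS --safe #-}

-- Sizes form a layering: a set of size i has exactly i subsets of size i - 1 among its
-- neighbours, and two distinct sets of equal size can only share their intersection below and
-- their union above.
--
-- For uniqueness, condition (4) makes labels add up around every square S, S ∖ y, S ∖ y ∖ z,
-- S ∖ z. Hence, once a singleton {a} has label 1, every vertex containing a is labelled by its
-- size, and label 1 spreads from a to x whenever {a, x} is independent. A vertex containing no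
-- singleton of label 1 lies in a component with the same property; a downward induction from
-- maximal independent sets shows that there removing an element raises the label, so
-- label + size is constant on the component. That constant is 3 (singletons have label at least
-- 2 there, and a vertex of label 3 would have three pairwise compatible lower neighbours, leading
-- to a vertex of label 0), so every vertex of the component has exactly two neighbours and the
-- component is a cycle, of even length since sizes alternate in parity: excluded by hypothesis.
-- Finally the top layer is nonempty and a maximum independent set has label α, so p = α.

module Submission where

open import Defs hiding (sym)
open import Data.Bool using (Bool; true; false; not; _∧_; T; T?)
open import Data.Bool.ListAction using (all)
import Data.Bool.Properties as Boolₚ
open import Data.Bool.Properties using (T-≡; T-not-≡)
open import Data.Empty using (⊥; ⊥-elim)
open import Data.Fin using (Fin; zero; suc; toℕ; fromℕ<)
import Data.Fin.Properties as Finₚ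
open import Data.Fin.Subset using (Subset; ∣_∣; ⁅_⁆; _∩_; _∪_; inside; outside; Nonempty)
  renaming (⊥ to ⊥ₛ; _∈_ to _∈ₛ_; _∉_ to _∉ₛ_; _⊆_ to _⊆ₛ_)
open import Data.Fin.Subset.Properties
  using ( _∈?_; nonempty?; x∈⁅x⁆; x∈⁅y⁆⇒x≡y; ∣⁅x⁆∣≡1; ∣p∣≤n; ∣⊥∣≡0; ∉⊥; ⊥⊆; ⊆-antisym; in⊆in; s⊆s; drop-there
        ; x∈p∩q⁺; x∈p∩q⁻; x∈p∪q⁺; x∈p∪q⁻ )
open import Data.List using (List; []; _∷_; length; filterᵇ; allFin)
import Data.List as List
import Data.List.Properties as Listₚ
open import Data.List.Membership.Propositional using (_∈_; _∉_)
import Data.List.Membership.DecPropositional as DecMembership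
open import Data.List.Membership.Propositional.Properties
  using (∈-filter⁺; ∈-filter⁻; ∈-lookup; ∈-allFin; ∈-map⁺; ∈-map⁻; ∈-++⁺ˡ; ∈-++⁺ʳ)
open import Data.List.Relation.Unary.All as All using (All)
open import Data.List.Relation.Unary.All.Properties using (all⁺; all⁻)
open import Data.List.Relation.Unary.AllPairs as AllPairs using (_∷_)
open import Data.List.Relation.Unary.Any as Any using (here; there; index; satisfied)
open import Data.List.Relation.Unary.Any.Properties using (lookup-index; any⁺; any⁻)
open import Data.List.Relation.Unary.Unique.Propositional using (Unique)
import Data.List.Relation.Unary.Unique.Propositional.Properties as Uniqueₚ
open import Data.Nat using (ℕ; zero; suc; _+_; _∸_; _⊔_; _≤_; _<_; _≡ᵇ_; z≤n; s≤s)
open import Data.Nat.Divisibility using (_∣_; divides; ∣-refl; ∣m∣n⇒∣m+n; ∣m+n∣m⇒∣n)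
open import Data.Nat.Induction using (<-rec)
import Data.Nat.Properties as ℕₚ
open import Data.Product using (Σ; ∃; ∃₂; _×_; _,_; proj₁; proj₂; uncurry)
open import Data.Sum as Sum using (_⊎_; inj₁; inj₂; [_,_]′)
open import Data.Unit using (tt)
open import Data.Vec using ([]; _∷_; lookup; _[_]≔_; here; there)
import Data.Vec.Properties as Vecₚ
open import Data.Vec.Properties
  using ( lookup∘update; lookup∘update′; []≔-idempotent; []≔-commutes; []≔-updates; []≔-minimal
        ; []≔-lookup; []=⇒lookup; lookup⇒[]=; zipWith-comm; ∷-injective )
open import Function using (_∘_; id)
open import Function.Bundles using (Equivalence; _⇔_; mk⇔)
open import Relation.Binary.Definitions using (DecidableEquality; tri<; tri≈; tri>)
open import Relation.Binary.PropositionalEquality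
open import Relation.Nullary using (¬_; yes; no; ¬?; Dec)
open import Relation.Nullary.Decidable using (_×-dec_)

module _ {A : Set} where

  lookup-injective : ∀ {xs : List A} → Unique xs →
                     ∀ i j → List.lookup xs i ≡ List.lookup xs j → i ≡ j
  lookup-injective (_ ∷ _) zero zero _ = refl
  lookup-injective (x∉ ∷ _) zero (suc j) e = ⊥-elim (All.lookup x∉ (∈-lookup j) e)
  lookup-injective (x∉ ∷ _) (suc i) zero e = ⊥-elim (All.lookup x∉ (∈-lookup i) (sym e))
  lookup-injective (_ ∷ xs!) (suc i) (suc j) e = cong suc (lookup-injective xs! i j e)

  unique-⊆⇒length≤ : ∀ {xs ys : List A} → Unique xs → (∀ {z} → z ∈ xs → z ∈ ys) →
                     length xs ≤ length ys
  unique-⊆⇒length≤ {xs} {ys} xs! xs⊆ys = Finₚ.injective⇒≤ position-injective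
    where
    position : Fin (length xs) → Fin (length ys)
    position i = index (xs⊆ys (∈-lookup i))
    position-injective : ∀ {i j} → position i ≡ position j → i ≡ j
    position-injective {i} {j} e = lookup-injective xs! i j (begin
      List.lookup xs i          ≡⟨ lookup-index (xs⊆ys (∈-lookup i)) ⟩
      List.lookup ys (position i) ≡⟨ cong (List.lookup ys) e ⟩
      List.lookup ys (position j) ≡⟨ lookup-index (xs⊆ys (∈-lookup j)) ⟨
      List.lookup xs j          ∎)
      where open ≡-Reasoning

  map-unique : ∀ {B : Set} {f : A → B} {xs} → Unique xs →
               (∀ {x y} → x ∈ xs → y ∈ xs → f x ≡ f y → x ≡ y) → Unique (List.map f xs)
  map-unique {xs = []} _ _ = AllPairs.[]
  map-unique {f = f} {xs = x ∷ xs} (x∉ ∷ xs!) f-inj =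
    All.tabulate fx≢ ∷ map-unique xs! (λ x∈ y∈ → f-inj (there x∈) (there y∈))
    where
    fx≢ : ∀ {z} → z ∈ List.map f xs → f x ≢ z
    fx≢ z∈ fx≡z with ∈-map⁻ f z∈
    ... | y , y∈xs , refl = All.lookup x∉ y∈xs (f-inj (here refl) (there y∈xs) fx≡z)

  module _ (p : A → Bool) where

    ∈-filterᵇ⁺ : ∀ {z xs} → z ∈ xs → p z ≡ true → z ∈ filterᵇ p xs
    ∈-filterᵇ⁺ z∈xs pz = ∈-filter⁺ (λ x → T? (p x)) z∈xs (Equivalence.from T-≡ pz)

    ∈-filterᵇ⁻ : ∀ {z xs} → z ∈ filterᵇ p xs → z ∈ xs × p z ≡ true
    ∈-filterᵇ⁻ {xs = xs} z∈ with ∈-filter⁻ (λ x → T? (p x)) {xs = xs} z∈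
    ... | z∈xs , pz = z∈xs , Equivalence.to T-≡ pz

    filterᵇ-unique : ∀ {xs} → Unique xs → Unique (filterᵇ p xs)
    filterᵇ-unique = Uniqueₚ.filter⁺ (λ x → T? (p x))

    countᵇ≤length : ∀ {xs ys} → Unique xs → (∀ {z} → z ∈ xs → p z ≡ true → z ∈ ys) →
                    countᵇ p xs ≤ length ys
    countᵇ≤length xs! sat⊆ys =
      unique-⊆⇒length≤ (filterᵇ-unique xs!) (λ z∈ → let z∈xs , pz = ∈-filterᵇ⁻ z∈ in sat⊆ys z∈xs pz)

    length≤countᵇ : ∀ {xs ys} → Unique ys → (∀ {z} → z ∈ ys → z ∈ xs × p z ≡ true) →
                    length ys ≤ countᵇ p xs
    length≤countᵇ ys! ys⊆sat =
      unique-⊆⇒length≤ ys! (λ z∈ys → let z∈xs , pz = ys⊆sat z∈ys in ∈-filterᵇ⁺ z∈xs pz)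

    countᵇ>0⇒satisfied : ∀ {xs} → 0 < countᵇ p xs → ∃ λ z → z ∈ xs × p z ≡ true
    countᵇ>0⇒satisfied {xs} c>0 with filterᵇ p xs in eq
    ... | z ∷ _ = z , ∈-filterᵇ⁻ (subst (z ∈_) (sym eq) (here refl))

    countᵇ≡2⇒ : ∀ {xs} → Unique xs → countᵇ p xs ≡ 2 →
                ∃₂ λ z₁ z₂ → z₁ ≢ z₂ × (z₁ ∈ xs × p z₁ ≡ true) × (z₂ ∈ xs × p z₂ ≡ true) ×
                  (∀ {z} → z ∈ xs → p z ≡ true → z ≡ z₁ ⊎ z ≡ z₂)
    countᵇ≡2⇒ {xs} xs! c≡2 with filterᵇ p xs in eq | filterᵇ-unique xs!
    ... | z₁ ∷ z₂ ∷ [] | (z₁∉ ∷ _) =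
      z₁ , z₂ , All.head z₁∉ , sat (here refl) , sat (there (here refl)) ,
      λ z∈xs pz → among (subst (_ ∈_) eq (∈-filterᵇ⁺ z∈xs pz))
      where
      sat : ∀ {z} → z ∈ z₁ ∷ z₂ ∷ [] → z ∈ xs × p z ≡ true
      sat z∈ = ∈-filterᵇ⁻ (subst (_ ∈_) (sym eq) z∈)
      among : ∀ {z} → z ∈ z₁ ∷ z₂ ∷ [] → z ≡ z₁ ⊎ z ≡ z₂
      among (here e) = inj₁ e
      among (there (here e)) = inj₂ e

    countᵇ≡3⇒ : ∀ {xs} → Unique xs → countᵇ p xs ≡ 3 →
                ∃₂ λ z₁ z₂ → ∃ λ z₃ → z₁ ≢ z₂ × z₁ ≢ z₃ × z₂ ≢ z₃ ×
                  (z₁ ∈ xs × p z₁ ≡ true) × (z₂ ∈ xs × p z₂ ≡ true) × (z₃ ∈ xs × p z₃ ≡ true) ×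
                  (∀ {z} → z ∈ xs → p z ≡ true → z ≡ z₁ ⊎ z ≡ z₂ ⊎ z ≡ z₃)
    countᵇ≡3⇒ {xs} xs! c≡3 with filterᵇ p xs in eq | filterᵇ-unique xs!
    ... | z₁ ∷ z₂ ∷ z₃ ∷ [] | (z₁∉ ∷ z₂∉ ∷ _) =
      z₁ , z₂ , z₃ , All.lookup z₁∉ (here refl) , All.lookup z₁∉ (there (here refl)) , All.head z₂∉ ,
      sat (here refl) , sat (there (here refl)) , sat (there (there (here refl))) ,
      λ z∈xs pz → among (subst (_ ∈_) eq (∈-filterᵇ⁺ z∈xs pz))
      where
      sat : ∀ {z} → z ∈ z₁ ∷ z₂ ∷ z₃ ∷ [] → z ∈ xs × p z ≡ true
      sat z∈ = ∈-filterᵇ⁻ (subst (_ ∈_) (sym eq) z∈)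
      among : ∀ {z} → z ∈ z₁ ∷ z₂ ∷ z₃ ∷ [] → z ≡ z₁ ⊎ z ≡ z₂ ⊎ z ≡ z₃
      among (here e) = inj₁ e
      among (there (here e)) = inj₂ (inj₁ e)
      among (there (there (here e))) = inj₂ (inj₂ e)

OneApart : ℕ → ℕ → Set
OneApart m m′ = m′ ≡ suc m ⊎ m ≡ suc m′

suc-∸1 : ∀ {m} → 1 ≤ m → suc (m ∸ 1) ≡ m
suc-∸1 {suc m} _ = refl

suc≢∸1 : ∀ m → suc m ≢ m ∸ 1
suc≢∸1 m e = ℕₚ.<⇒≢ (s≤s (ℕₚ.m∸n≤m m 1)) (sym e)

split-3 : ∀ {l s} → l + s ≡ 3 → 1 ≤ l → 1 ≤ s → (l ≡ 2 × s ≡ 1) ⊎ (l ≡ 1 × s ≡ 2)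
split-3 {1} l+s≡3 _ _ = inj₂ (refl , ℕₚ.suc-injective l+s≡3)
split-3 {2} l+s≡3 _ _ = inj₁ (refl , ℕₚ.suc-injective (ℕₚ.suc-injective l+s≡3))
split-3 {suc (suc (suc l))} {suc s} l+s≡3 _ _ =
  ⊥-elim (ℕₚ.1+n≢0 (ℕₚ.m+n≡0⇒n≡0 l (ℕₚ.suc-injective (ℕₚ.suc-injective (ℕₚ.suc-injective l+s≡3)))))

OneApart⇒≢ : ∀ {m m′} → OneApart m m′ → m ≢ m′
OneApart⇒≢ (inj₁ m′≡1+m) refl = ℕₚ.1+n≢n (sym m′≡1+m)
OneApart⇒≢ (inj₂ m≡1+m′) refl = ℕₚ.1+n≢n (sym m≡1+m′)

OneApart⇒+1 : ∀ {m m′} → OneApart m m′ → m′ ≡ m + 1 ⊎ m ≡ m′ + 1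
OneApart⇒+1 {m} (inj₁ m′≡1+m) = inj₁ (trans m′≡1+m (ℕₚ.+-comm 1 m))
OneApart⇒+1 {m′ = m′} (inj₂ m≡1+m′) = inj₂ (trans m≡1+m′ (ℕₚ.+-comm 1 m′))

2∣m+m : ∀ m → 2 ∣ m + m
2∣m+m m = divides m (trans (cong (m +_) (sym (ℕₚ.+-identityʳ m))) (ℕₚ.*-comm 2 m))

square-arith : ∀ {a b c d} → OneApart a b → OneApart a c → OneApart b d → OneApart c d →
               a + d ≡ b + c ⊎ (b ≡ c × a ≡ d)
square-arith {a} (inj₁ refl) (inj₁ refl) (inj₁ refl) _ = inj₁ (ℕₚ.+-suc a (suc a))
square-arith (inj₁ refl) (inj₁ refl) (inj₂ refl) _ = inj₂ (refl , refl)
square-arith (inj₁ refl) (inj₂ refl) (inj₁ refl) (inj₁ ())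
square-arith (inj₁ refl) (inj₂ refl) (inj₁ refl) (inj₂ ())
square-arith {c = c} (inj₁ refl) (inj₂ refl) (inj₂ refl) _ = inj₁ (cong suc (ℕₚ.+-suc c c))
square-arith {b = b} (inj₂ refl) (inj₁ refl) (inj₁ refl) _ = inj₁ (sym (ℕₚ.+-suc b (suc b)))
square-arith (inj₂ refl) (inj₁ refl) (inj₂ refl) (inj₁ ())
square-arith (inj₂ refl) (inj₁ refl) (inj₂ refl) (inj₂ ())
square-arith (inj₂ refl) (inj₂ refl) (inj₁ refl) _ = inj₂ (refl , refl)
square-arith {d = d} (inj₂ refl) (inj₂ refl) (inj₂ refl) _ = inj₁ (cong suc (sym (ℕₚ.+-suc d d)))

Least : (ℕ → Set) → Set
Least P = ∃ λ K → P K × (∀ {k} → k < K → ¬ P k)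

least-witness : ∀ {P : ℕ → Set} → (∀ k → Dec (P k)) → ∀ {m} → P m → Least P
least-witness {P} P? {m} = <-rec (λ m → P m → Least P) search m
  where
  search : ∀ m → (∀ {k} → k < m → P k → Least P) → P m → Least P
  search m earlier Pm with ℕₚ.anyUpTo? P? m
  ... | yes (k , k<m , Pk) = earlier k<m Pk
  ... | no none = m , Pm , λ k<m Pk → none (_ , k<m , Pk)

≡ᵇ≡true⇒≡ : ∀ {m m′} → (m ≡ᵇ m′) ≡ true → m ≡ m′
≡ᵇ≡true⇒≡ {m} {m′} e = ℕₚ.≡ᵇ⇒≡ m m′ (Equivalence.from T-≡ e)

≡⇒≡ᵇ≡true : ∀ {m m′} → m ≡ m′ → (m ≡ᵇ m′) ≡ true
≡⇒≡ᵇ≡true {m} {m′} e = Equivalence.to T-≡ (ℕₚ.≡⇒≡ᵇ m m′ e)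

∧≡true⁻ : ∀ {a b} → a ∧ b ≡ true → a ≡ true × b ≡ true
∧≡true⁻ {true} {true} _ = refl , refl

infixl 6 _∖_ _⊕_

_∖_ : ∀ {n} → Subset n → Fin n → Subset n
S ∖ i = S [ i ]≔ outside

_⊕_ : ∀ {n} → Subset n → Fin n → Subset n
S ⊕ i = S [ i ]≔ inside

private
  variable
    n : ℕ
    S R : Subset n
    i j : Fin n

∉ₛ⇒lookup≡outside : ∀ (S : Subset n) → i ∉ₛ S → lookup S i ≡ outside
∉ₛ⇒lookup≡outside {i = i} S i∉S with lookup S i in eq
... | false = refl
... | true = ⊥-elim (i∉S (lookup⇒[]= i S eq))

∈-[]≔⁻ : ∀ (S : Subset n) {b} → j ≢ i → j ∈ₛ S [ i ]≔ b → j ∈ₛ S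
∈-[]≔⁻ {j = j} S {b} j≢i j∈ = lookup⇒[]= j S (trans (sym (lookup∘update′ j≢i S b)) ([]=⇒lookup j∈))

i∈S⊕i : ∀ (S : Subset n) i → i ∈ₛ S ⊕ i
i∈S⊕i S i = []≔-updates S i

i∉S∖i : ∀ (S : Subset n) i → i ∉ₛ S ∖ i
i∉S∖i S i i∈ with () ← trans (sym ([]=⇒lookup i∈)) (lookup∘update i S outside)

∈-⊕⁺ : ∀ i → j ∈ₛ S → j ∈ₛ S ⊕ i
∈-⊕⁺ {j = j} {S = S} i j∈S with j Finₚ.≟ i
... | yes refl = []≔-updates S j
... | no j≢i = []≔-minimal S j i j≢i j∈S

∈-⊕⁻ : ∀ (S : Subset n) i → j ∈ₛ S ⊕ i → j ≡ i ⊎ j ∈ₛ S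
∈-⊕⁻ {j = j} S i j∈ with j Finₚ.≟ i
... | yes j≡i = inj₁ j≡i
... | no j≢i = inj₂ (∈-[]≔⁻ S j≢i j∈)

∉-⊕⁺ : ∀ i → j ≢ i → j ∉ₛ S → j ∉ₛ S ⊕ i
∉-⊕⁺ {S = S} i j≢i j∉S j∈ = j∉S (∈-[]≔⁻ S j≢i j∈)

∈-∖⁺ : ∀ i → j ≢ i → j ∈ₛ S → j ∈ₛ S ∖ i
∈-∖⁺ {j = j} {S = S} i j≢i j∈S = []≔-minimal S j i j≢i j∈S

∈-∖⁻ : ∀ (S : Subset n) i → j ∈ₛ S ∖ i → j ≢ i × j ∈ₛ S
∈-∖⁻ {j = j} S i j∈ = j≢i , ∈-[]≔⁻ S j≢i j∈
  where
  j≢i : j ≢ i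
  j≢i refl = i∉S∖i S i j∈

S∖i⊆S : ∀ (S : Subset n) i → S ∖ i ⊆ₛ S
S∖i⊆S S i j∈ = proj₂ (∈-∖⁻ S i j∈)

S⊕i∖i≡S : i ∉ₛ S → S ⊕ i ∖ i ≡ S
S⊕i∖i≡S {i = i} {S = S} i∉S = begin
  S [ i ]≔ inside [ i ]≔ outside ≡⟨ []≔-idempotent S i ⟩
  S [ i ]≔ outside               ≡⟨ cong (S [ i ]≔_) (∉ₛ⇒lookup≡outside S i∉S) ⟨
  S [ i ]≔ lookup S i            ≡⟨ []≔-lookup S i ⟩
  S                              ∎
  where open ≡-Reasoning

S∖i⊕i≡S : i ∈ₛ S → S ∖ i ⊕ i ≡ S
S∖i⊕i≡S {i = i} {S = S} i∈S = begin
  S [ i ]≔ outside [ i ]≔ inside ≡⟨ []≔-idempotent S i ⟩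
  S [ i ]≔ inside                ≡⟨ cong (S [ i ]≔_) ([]=⇒lookup i∈S) ⟨
  S [ i ]≔ lookup S i            ≡⟨ []≔-lookup S i ⟩
  S                              ∎
  where open ≡-Reasoning

⊕-injective : i ∉ₛ S → S ⊕ i ≡ S ⊕ j → i ≡ j
⊕-injective {i = i} {S = S} {j = j} i∉S S⊕i≡S⊕j =
  [ id , ⊥-elim ∘ i∉S ]′ (∈-⊕⁻ S j (subst (i ∈ₛ_) S⊕i≡S⊕j (i∈S⊕i S i)))

⊕-mono : S ⊆ₛ R → ∀ i → S ⊕ i ⊆ₛ R ⊕ i
⊕-mono {S = S} S⊆R i k∈ = [ (λ { refl → i∈S⊕i _ i }) , ∈-⊕⁺ i ∘ S⊆R ]′ (∈-⊕⁻ S i k∈)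

∖-comm : ∀ (S : Subset n) i j → S ∖ i ∖ j ≡ S ∖ j ∖ i
∖-comm S i j with i Finₚ.≟ j
... | yes refl = refl
... | no i≢j = []≔-commutes S i j i≢j

⊕-∖-comm : ∀ (S : Subset n) i j → j ≢ i → S ⊕ j ∖ i ≡ S ∖ i ⊕ j
⊕-∖-comm S i j j≢i = []≔-commutes S j i j≢i

infixl 6 _∖∗_

_∖∗_ : Subset n → List (Fin n) → Subset n
S ∖∗ [] = S
S ∖∗ (y ∷ ys) = S ∖∗ ys ∖ y

∖∗-⊆ : ∀ (S : Subset n) ys → S ∖∗ ys ⊆ₛ S
∖∗-⊆ S [] j∈ = j∈
∖∗-⊆ S (y ∷ ys) j∈ = ∖∗-⊆ S ys (S∖i⊆S (S ∖∗ ys) y j∈)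

∈-∖∗⁺ : ∀ ys → j ∉ ys → j ∈ₛ S → j ∈ₛ S ∖∗ ys
∈-∖∗⁺ [] _ j∈S = j∈S
∈-∖∗⁺ (y ∷ ys) j∉ j∈S = ∈-∖⁺ y (j∉ ∘ here) (∈-∖∗⁺ ys (j∉ ∘ there) j∈S)

∣S∖i∣ : i ∈ₛ S → suc ∣ S ∖ i ∣ ≡ ∣ S ∣
∣S∖i∣ here = refl
∣S∖i∣ {S = true ∷ S} (there i∈S) = cong suc (∣S∖i∣ i∈S)
∣S∖i∣ {S = false ∷ S} (there i∈S) = ∣S∖i∣ i∈S

∣S⊕i∣ : ∀ (S : Subset n) i → i ∉ₛ S → ∣ S ⊕ i ∣ ≡ suc ∣ S ∣
∣S⊕i∣ (false ∷ S) zero _ = refl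
∣S⊕i∣ (true ∷ S) zero i∉S = ⊥-elim (i∉S here)
∣S⊕i∣ (true ∷ S) (suc i) i∉S = cong suc (∣S⊕i∣ S i (i∉S ∘ there))
∣S⊕i∣ (false ∷ S) (suc i) i∉S = ∣S⊕i∣ S i (i∉S ∘ there)

i∈S⇒∣S∣>0 : i ∈ₛ S → 0 < ∣ S ∣
i∈S⇒∣S∣>0 i∈S = subst (0 <_) (∣S∖i∣ i∈S) (s≤s z≤n)

∣S∣>0⇒nonempty : ∀ (S : Subset n) → 0 < ∣ S ∣ → Nonempty S
∣S∣>0⇒nonempty (true ∷ S) _ = zero , here
∣S∣>0⇒nonempty (false ∷ S) ∣S∣>0 with ∣S∣>0⇒nonempty S ∣S∣>0
... | i , i∈S = suc i , there i∈S

∣S∣≡0⇒∉ : ∣ S ∣ ≡ 0 → i ∉ₛ S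
∣S∣≡0⇒∉ ∣S∣≡0 i∈S = ℕₚ.<⇒≢ (i∈S⇒∣S∣>0 i∈S) (sym ∣S∣≡0)

∣S∣≡1⇒S≡⁅i⁆ : i ∈ₛ S → ∣ S ∣ ≡ 1 → S ≡ ⁅ i ⁆
∣S∣≡1⇒S≡⁅i⁆ {i = i} {S = S} i∈S ∣S∣≡1 = ⊆-antisym S⊆⁅i⁆ ⁅i⁆⊆S
  where
  S⊆⁅i⁆ : S ⊆ₛ ⁅ i ⁆
  S⊆⁅i⁆ {j} j∈S with j Finₚ.≟ i
  ... | yes refl = x∈⁅x⁆ j
  ... | no j≢i = ⊥-elim (∣S∣≡0⇒∉ (ℕₚ.suc-injective (trans (∣S∖i∣ i∈S) ∣S∣≡1)) (∈-∖⁺ i j≢i j∈S))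
  ⁅i⁆⊆S : ⁅ i ⁆ ⊆ₛ S
  ⁅i⁆⊆S j∈⁅i⁆ = subst (_∈ₛ S) (sym (x∈⁅y⁆⇒x≡y i j∈⁅i⁆)) i∈S

another-element : i ∈ₛ S → 2 ≤ ∣ S ∣ → ∃ λ j → j ≢ i × j ∈ₛ S
another-element {i = i} {S = S} i∈S ∣S∣≥2
  with ∣S∣>0⇒nonempty (S ∖ i) (ℕₚ.≤-pred (subst (2 ≤_) (sym (∣S∖i∣ i∈S)) ∣S∣≥2))
... | j , j∈S∖i = j , ∈-∖⁻ S i j∈S∖i

⁅i⁆⊕j⊆S : i ∈ₛ S → j ∈ₛ S → ⁅ i ⁆ ⊕ j ⊆ₛ S
⁅i⁆⊕j⊆S {i = i} {S = S} {j = j} i∈S j∈S k∈ with ∈-⊕⁻ ⁅ i ⁆ j k∈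
... | inj₁ refl = j∈S
... | inj₂ k∈⁅i⁆ = subst (_∈ₛ S) (sym (x∈⁅y⁆⇒x≡y i k∈⁅i⁆)) i∈S

∣S∣≡2⇒pair : ∣ S ∣ ≡ 2 → i ∈ₛ S → j ∈ₛ S → j ≢ i → ∀ {k} → k ∈ₛ S → k ≡ i ⊎ k ≡ j
∣S∣≡2⇒pair {S = S} {i = i} {j = j} ∣S∣≡2 i∈S j∈S j≢i {k} k∈S with k Finₚ.≟ i | k Finₚ.≟ j
... | yes k≡i | _ = inj₁ k≡i
... | no _ | yes k≡j = inj₂ k≡j
... | no k≢i | no k≢j = ⊥-elim (∣S∣≡0⇒∉ ∣S∖i∖j∣≡0 (∈-∖⁺ j k≢j (∈-∖⁺ i k≢i k∈S)))
  where
  ∣S∖i∖j∣≡0 : ∣ S ∖ i ∖ j ∣ ≡ 0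
  ∣S∖i∖j∣≡0 = ℕₚ.suc-injective (trans (∣S∖i∣ (∈-∖⁺ i j≢i j∈S)) (ℕₚ.suc-injective (trans (∣S∖i∣ i∈S) ∣S∣≡2)))

two-other-elements : i ∈ₛ S → 3 ≤ ∣ S ∣ → ∃₂ λ j k → j ≢ i × k ≢ i × j ≢ k × j ∈ₛ S × k ∈ₛ S
two-other-elements {i = i} {S = S} i∈S ∣S∣≥3 with another-element i∈S (ℕₚ.<⇒≤ ∣S∣≥3)
... | j , j≢i , j∈S with another-element (∈-∖⁺ j (j≢i ∘ sym) i∈S)
                          (ℕₚ.≤-pred (subst (3 ≤_) (sym (∣S∖i∣ j∈S)) ∣S∣≥3))
...   | k , k≢i , k∈S∖j = j , k , j≢i , k≢i , proj₁ (∈-∖⁻ S j k∈S∖j) ∘ sym , j∈S , S∖i⊆S S j k∈S∖j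

subset-of-size : ∀ (S : Subset n) k → k ≤ ∣ S ∣ → ∃ λ R → R ⊆ₛ S × ∣ R ∣ ≡ k
subset-of-size {n} S zero _ = ⊥ₛ , ⊥⊆ , ∣⊥∣≡0 n
subset-of-size (true ∷ S) (suc k) (s≤s k≤∣S∣) with subset-of-size S k k≤∣S∣
... | R , R⊆S , ∣R∣≡k = true ∷ R , in⊆in R⊆S , cong suc ∣R∣≡k
subset-of-size (false ∷ S) (suc k) k<∣S∣ with subset-of-size S (suc k) k<∣S∣
... | R , R⊆S , ∣R∣≡k = false ∷ R , s⊆s R⊆S , ∣R∣≡k

elements : Subset n → List (Fin n)
elements S = filterᵇ (lookup S) (allFin _)

length-filterᵇ-tabulate : ∀ {A : Set} (S : Subset n) (h : Fin n → A) (p : A → Bool) →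
                          (∀ i → p (h i) ≡ lookup S i) → length (filterᵇ p (List.tabulate h)) ≡ ∣ S ∣
length-filterᵇ-tabulate [] h p _ = refl
length-filterᵇ-tabulate (b ∷ S) h p p∘h≡S with p (h zero) | p∘h≡S zero
... | true | refl = cong suc (length-filterᵇ-tabulate S (h ∘ suc) p (p∘h≡S ∘ suc))
... | false | refl = length-filterᵇ-tabulate S (h ∘ suc) p (p∘h≡S ∘ suc)

length-elements : ∀ (S : Subset n) → length (elements S) ≡ ∣ S ∣
length-elements S = length-filterᵇ-tabulate S (λ i → i) (lookup S) (λ _ → refl)

∈-elements⁺ : ∀ {S : Subset n} {i} → i ∈ₛ S → i ∈ elements S
∈-elements⁺ {i = i} i∈S = ∈-filterᵇ⁺ _ (∈-allFin i) ([]=⇒lookup i∈S)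

∈-elements⁻ : ∀ (S : Subset n) {i} → i ∈ elements S → i ∈ₛ S
∈-elements⁻ S {i} i∈ = lookup⇒[]= i S (proj₂ (∈-filterᵇ⁻ (lookup S) {xs = allFin _} i∈))

elements-unique : ∀ (S : Subset n) → Unique (elements S)
elements-unique {n} S = filterᵇ-unique (lookup S) (Uniqueₚ.allFin⁺ n)

common-removal : ∀ {U W : Subset n} {i j} → U ≢ W → i ∈ₛ U → j ∈ₛ W → U ∖ i ≡ W ∖ j → U ∖ i ≡ U ∩ W
common-removal {U = U} {W} {i} {j} U≢W i∈U j∈W U∖i≡W∖j = ⊆-antisym ⊆∩ ∩⊆
  where
  ⊆∩ : U ∖ i ⊆ₛ U ∩ W
  ⊆∩ k∈ = x∈p∩q⁺ (S∖i⊆S U i k∈ , S∖i⊆S W j (subst (_ ∈ₛ_) U∖i≡W∖j k∈))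
  ∩⊆ : U ∩ W ⊆ₛ U ∖ i
  ∩⊆ {k} k∈ with x∈p∩q⁻ U W k∈ | k Finₚ.≟ i
  ... | k∈U , _ | no k≢i = ∈-∖⁺ i k≢i k∈U
  ... | _ , i∈W | yes refl with i Finₚ.≟ j
  ...   | no i≢j = subst (_ ∈ₛ_) (sym U∖i≡W∖j) (∈-∖⁺ j i≢j i∈W)
  ...   | yes refl = ⊥-elim (U≢W (begin
          U         ≡⟨ S∖i⊕i≡S i∈U ⟨
          U ∖ i ⊕ i ≡⟨ cong (_⊕ i) U∖i≡W∖j ⟩
          W ∖ i ⊕ i ≡⟨ S∖i⊕i≡S j∈W ⟩
          W         ∎))
    where open ≡-Reasoning

common-insertion : ∀ {U W : Subset n} {i j} → U ≢ W → i ∉ₛ U → j ∉ₛ W → U ⊕ i ≡ W ⊕ j → U ⊕ i ≡ U ∪ W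
common-insertion {U = U} {W} {i} {j} U≢W i∉U j∉W U⊕i≡W⊕j = ⊆-antisym ⊆∪ ∪⊆
  where
  ⊆∪ : U ⊕ i ⊆ₛ U ∪ W
  ⊆∪ {k} k∈ with ∈-⊕⁻ U i k∈
  ... | inj₂ k∈U = x∈p∪q⁺ (inj₁ k∈U)
  ... | inj₁ refl with ∈-⊕⁻ W j (subst (_ ∈ₛ_) U⊕i≡W⊕j (i∈S⊕i U i))
  ...   | inj₂ i∈W = x∈p∪q⁺ (inj₂ i∈W)
  ...   | inj₁ refl = ⊥-elim (U≢W (begin
          U         ≡⟨ S⊕i∖i≡S i∉U ⟨
          U ⊕ i ∖ i ≡⟨ cong (_∖ i) U⊕i≡W⊕j ⟩
          W ⊕ i ∖ i ≡⟨ S⊕i∖i≡S j∉W ⟩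
          W         ∎))
    where open ≡-Reasoning
  ∪⊆ : U ∪ W ⊆ₛ U ⊕ i
  ∪⊆ k∈ with x∈p∪q⁻ U W k∈
  ... | inj₁ k∈U = ∈-⊕⁺ i k∈U
  ... | inj₂ k∈W = subst (_ ∈ₛ_) (sym U⊕i≡W⊕j) (∈-⊕⁺ j k∈W)

∖-injective : i ∈ₛ S → S ∖ i ≡ S ∖ j → i ≡ j
∖-injective {i = i} {S = S} {j = j} i∈S S∖i≡S∖j with i Finₚ.≟ j
... | yes i≡j = i≡j
... | no i≢j = ⊥-elim (i∉S∖i S i (subst (i ∈ₛ_) (sym S∖i≡S∖j) (∈-∖⁺ j i≢j i∈S)))

-- Single-element steps, the edges of I¹_AR

data Step {n} (S R : Subset n) : Set where
  remove : i ∈ₛ S → R ≡ S ∖ i → Step S R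
  insert : i ∉ₛ S → R ≡ S ⊕ i → Step S R

Step-size : Step S R → OneApart ∣ S ∣ ∣ R ∣
Step-size (remove i∈S refl) = inj₂ (sym (∣S∖i∣ i∈S))
Step-size {S = S} (insert i∉S refl) = inj₁ (∣S⊕i∣ S _ i∉S)

∣S△S∣≡0 : ∀ (S : Subset n) → ∣ S △ S ∣ ≡ 0
∣S△S∣≡0 [] = refl
∣S△S∣≡0 (true ∷ S) = ∣S△S∣≡0 S
∣S△S∣≡0 (false ∷ S) = ∣S△S∣≡0 S

∣S△flip∣≡1 : ∀ (S : Subset n) i → ∣ S △ (S [ i ]≔ not (lookup S i)) ∣ ≡ 1
∣S△flip∣≡1 (true ∷ S) zero = cong suc (∣S△S∣≡0 S)
∣S△flip∣≡1 (false ∷ S) zero = cong suc (∣S△S∣≡0 S)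
∣S△flip∣≡1 (true ∷ S) (suc i) = ∣S△flip∣≡1 S i
∣S△flip∣≡1 (false ∷ S) (suc i) = ∣S△flip∣≡1 S i

Step⇒∣△∣≡1 : Step S R → ∣ S △ R ∣ ≡ 1
Step⇒∣△∣≡1 {S = S} (remove {i} i∈S refl) =
  subst (λ b → ∣ S △ (S [ i ]≔ b) ∣ ≡ 1) (cong not ([]=⇒lookup i∈S)) (∣S△flip∣≡1 S i)
Step⇒∣△∣≡1 {S = S} (insert {i} i∉S refl) =
  subst (λ b → ∣ S △ (S [ i ]≔ b) ∣ ≡ 1) (cong not (∉ₛ⇒lookup≡outside S i∉S)) (∣S△flip∣≡1 S i)

∣△∣≡0⇒≡ : ∀ (S R : Subset n) → ∣ S △ R ∣ ≡ 0 → S ≡ R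
∣△∣≡0⇒≡ [] [] _ = refl
∣△∣≡0⇒≡ (true ∷ S) (true ∷ R) e = cong (true ∷_) (∣△∣≡0⇒≡ S R e)
∣△∣≡0⇒≡ (false ∷ S) (false ∷ R) e = cong (false ∷_) (∣△∣≡0⇒≡ S R e)

Step-∷ : ∀ b → Step S R → Step (b ∷ S) (b ∷ R)
Step-∷ b (remove i∈S refl) = remove (there i∈S) refl
Step-∷ b (insert i∉S refl) = insert (i∉S ∘ drop-there) refl

∣△∣≡1⇒Step : ∀ (S R : Subset n) → ∣ S △ R ∣ ≡ 1 → Step S R
∣△∣≡1⇒Step [] [] ()
∣△∣≡1⇒Step (true ∷ S) (true ∷ R) e = Step-∷ true (∣△∣≡1⇒Step S R e)
∣△∣≡1⇒Step (false ∷ S) (false ∷ R) e = Step-∷ false (∣△∣≡1⇒Step S R e)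
∣△∣≡1⇒Step (true ∷ S) (false ∷ R) e =
  remove here (cong (false ∷_) (sym (∣△∣≡0⇒≡ S R (ℕₚ.suc-injective e))))
∣△∣≡1⇒Step (false ∷ S) (true ∷ R) e =
  insert {i = zero} (λ ()) (cong (true ∷_) (sym (∣△∣≡0⇒≡ S R (ℕₚ.suc-injective e))))

Step-sym : Step S R → Step R S
Step-sym {S = S} (remove {i} i∈S refl) = insert (i∉S∖i S i) (sym (S∖i⊕i≡S i∈S))
Step-sym {S = S} (insert {i} i∉S refl) = remove (i∈S⊕i S i) (sym (S⊕i∖i≡S i∉S))

edge⇒Step : ∀ (S R : Subset n) → (∣ S △ R ∣ ≡ᵇ 1) ≡ true → Step S R
edge⇒Step S R e = ∣△∣≡1⇒Step S R (≡ᵇ≡true⇒≡ e)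

Step⇒edge : Step S R → (∣ S △ R ∣ ≡ᵇ 1) ≡ true
Step⇒edge st = ≡⇒≡ᵇ≡true (Step⇒∣△∣≡1 st)

edge-sym : ∀ (S R : Subset n) → (∣ S △ R ∣ ≡ᵇ 1) ≡ (∣ R △ S ∣ ≡ᵇ 1)
edge-sym S R = cong (λ D → ∣ D ∣ ≡ᵇ 1) (zipWith-comm Boolₚ.xor-comm S R)

∈-allSubsets : ∀ (S : Subset n) → S ∈ allSubsets n
∈-allSubsets [] = here refl
∈-allSubsets {suc n} (true ∷ S) = ∈-++⁺ˡ (∈-map⁺ (true ∷_) (∈-allSubsets S))
∈-allSubsets {suc n} (false ∷ S) = ∈-++⁺ʳ (List.map (true ∷_) (allSubsets n)) (∈-map⁺ (false ∷_) (∈-allSubsets S))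

allSubsets-unique : ∀ n → Unique (allSubsets n)
allSubsets-unique zero = All.[] ∷ AllPairs.[]
allSubsets-unique (suc n) = Uniqueₚ.++⁺ (prefixed true) (prefixed false) disjoint
  where
  prefixed : ∀ b → Unique (List.map (b ∷_) (allSubsets n))
  prefixed b = Uniqueₚ.map⁺ (proj₂ ∘ ∷-injective) (allSubsets-unique n)
  disjoint : ∀ {S} → ¬ (S ∈ List.map (true ∷_) (allSubsets n) × S ∈ List.map (false ∷_) (allSubsets n))
  disjoint (S∈ , S∈′) with ∈-map⁻ (true ∷_) S∈ | ∈-map⁻ (false ∷_) S∈′
  ... | _ , _ , refl | _ , _ , ()

module _ {n} (G : SimpleGraph n) where

  Independent : Subset n → Set
  Independent S = ∀ {i j} → i ∈ₛ S → j ∈ₛ S → adj G i j ≡ false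

  private
    compatible : Subset n → Fin n → Fin n → Bool
    compatible S i j = not (lookup S i ∧ lookup S j ∧ adj G i j)

  isIndependent⇒Independent : ∀ {S} → isIndependent G S ≡ true → Independent S
  isIndependent⇒Independent {S = S} e {i} {j} i∈S j∈S =
    Equivalence.to T-not-≡
      (subst₂ (λ a b → T (not (a ∧ b ∧ adj G i j))) ([]=⇒lookup i∈S) ([]=⇒lookup j∈S) pair-ok)
    where
    pair-ok : T (compatible S i j)
    row-ok : T (all (compatible S i) (allFin n))
    row-ok = All.lookup (all⁺ (λ i → all (compatible S i) (allFin n)) (allFin n) (Equivalence.from T-≡ e)) (∈-allFin i)
    pair-ok = All.lookup (all⁺ (compatible S i) (allFin n) row-ok) (∈-allFin j)

  Independent⇒isIndependent : ∀ {S} → Independent S → isIndependent G S ≡ true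
  Independent⇒isIndependent {S = S} ind =
    Equivalence.to T-≡ (all⁻ (λ i → all (compatible S i) (allFin n)) {xs = allFin n}
      (All.tabulate λ {i} _ → all⁻ (compatible S i) {xs = allFin n} (All.tabulate λ {j} _ → pair-ok i j)))
    where
    pair-ok : ∀ i j → T (compatible S i j)
    pair-ok i j with lookup S i in ei | lookup S j in ej
    ... | false | _ = tt
    ... | true | false = tt
    ... | true | true = Equivalence.from T-not-≡ (ind (lookup⇒[]= i S ei) (lookup⇒[]= j S ej))

  isNonempty⇒Nonempty : ∀ {S : Subset n} → isNonempty S ≡ true → Nonempty S
  isNonempty⇒Nonempty {S = S} e with satisfied (any⁻ (lookup S) (allFin n) (Equivalence.from T-≡ e))
  ... | i , Ti = i , lookup⇒[]= i S (Equivalence.to T-≡ Ti)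

  Nonempty⇒isNonempty : ∀ {S : Subset n} → Nonempty S → isNonempty S ≡ true
  Nonempty⇒isNonempty {S = S} (i , i∈S) =
    Equivalence.to T-≡
      (any⁺ (lookup S) (Any.map (λ { refl → Equivalence.from T-≡ ([]=⇒lookup i∈S) }) (∈-allFin i)))

  ∈IAR⁻ : ∀ {S} → S ∈ verts (IAR G) → Independent S × Nonempty S
  ∈IAR⁻ S∈ with ∧≡true⁻ (proj₂ (∈-filterᵇ⁻ (λ S → isIndependent G S ∧ isNonempty S) {xs = allSubsets n} S∈))
  ... | ind , ne = isIndependent⇒Independent ind , isNonempty⇒Nonempty ne

  ∈IAR⁺ : ∀ {S} → Independent S → Nonempty S → S ∈ verts (IAR G)
  ∈IAR⁺ {S = S} ind ne = ∈-filterᵇ⁺ (λ S → isIndependent G S ∧ isNonempty S) (∈-allSubsets S)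
                           (cong₂ _∧_ (Independent⇒isIndependent ind) (Nonempty⇒isNonempty ne))

  IAR-unique : Unique (verts (IAR G))
  IAR-unique = filterᵇ-unique (λ S → isIndependent G S ∧ isNonempty S) (allSubsets-unique n)

  ⊆-∈IAR : ∀ {S R i} → S ∈ verts (IAR G) → R ⊆ₛ S → i ∈ₛ R → R ∈ verts (IAR G)
  ⊆-∈IAR S∈ R⊆S i∈R = ∈IAR⁺ (λ i∈ j∈ → proj₁ (∈IAR⁻ S∈) (R⊆S i∈) (R⊆S j∈)) (_ , i∈R)

  ⁅i⁆∈IAR : ∀ i → ⁅ i ⁆ ∈ verts (IAR G)
  ⁅i⁆∈IAR i = ∈IAR⁺ singleton-independent (i , x∈⁅x⁆ i)
    where
    singleton-independent : Independent ⁅ i ⁆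
    singleton-independent j∈ k∈ rewrite x∈⁅y⁆⇒x≡y i j∈ | x∈⁅y⁆⇒x≡y i k∈ = irrefl G i

  -- Every pair of elements of S ⊕ a ⊕ b ⊕ c avoids one of a, b, c.
  triple-independent : ∀ {S a b c} → Independent (S ⊕ a ⊕ b) → Independent (S ⊕ a ⊕ c) →
                       Independent (S ⊕ b ⊕ c) → Independent (S ⊕ a ⊕ b ⊕ c)
  triple-independent {S} {a} {b} {c} ab-ind ac-ind bc-ind {i} {j} i∈ j∈ = by-cases (i Finₚ.≟ c) (j Finₚ.≟ c)
    where
    without-c : ∀ {k} → k ∈ₛ S ⊕ a ⊕ b ⊕ c → k ≢ c → k ∈ₛ S ⊕ a ⊕ b
    without-c k∈ k≢c = [ ⊥-elim ∘ k≢c , id ]′ (∈-⊕⁻ (S ⊕ a ⊕ b) c k∈)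
    without-b : ∀ {k} → k ∈ₛ S ⊕ a ⊕ b ⊕ c → k ≢ b → k ∈ₛ S ⊕ a ⊕ c
    without-b k∈ k≢b with ∈-⊕⁻ (S ⊕ a ⊕ b) c k∈
    ... | inj₁ refl = i∈S⊕i (S ⊕ a) c
    ... | inj₂ k∈ab = ∈-⊕⁺ c ([ ⊥-elim ∘ k≢b , id ]′ (∈-⊕⁻ (S ⊕ a) b k∈ab))
    b∈bc : b ∈ₛ S ⊕ b ⊕ c
    b∈bc = ∈-⊕⁺ c (i∈S⊕i S b)
    by-cases : Dec (i ≡ c) → Dec (j ≡ c) → adj G i j ≡ false
    by-cases (no i≢c) (no j≢c) = ab-ind (without-c i∈ i≢c) (without-c j∈ j≢c)
    by-cases (yes refl) _ with j Finₚ.≟ b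
    ... | yes refl = bc-ind (i∈S⊕i (S ⊕ b) i) b∈bc
    ... | no j≢b = ac-ind (i∈S⊕i (S ⊕ a) i) (without-b j∈ j≢b)
    by-cases (no _) (yes refl) with i Finₚ.≟ b
    ... | yes refl = bc-ind b∈bc (i∈S⊕i (S ⊕ b) j)
    ... | no i≢b = ac-ind (without-b i∈ i≢b) (i∈S⊕i (S ⊕ a) j)

module _ {A : Set} (f : A → ℕ) where

  ⨆ : List A → ℕ
  ⨆ = List.foldr (λ x m → f x ⊔ m) 0

  ≤-⨆ : ∀ {x xs} → x ∈ xs → f x ≤ ⨆ xs
  ≤-⨆ {xs = y ∷ xs} (here refl) = ℕₚ.m≤m⊔n (f y) (⨆ xs)
  ≤-⨆ {xs = y ∷ xs} (there x∈xs) = ℕₚ.≤-trans (≤-⨆ x∈xs) (ℕₚ.m≤n⊔m (f y) (⨆ xs))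

  ⨆-attained : ∀ xs → ⨆ xs ≡ 0 ⊎ ∃ λ x → x ∈ xs × f x ≡ ⨆ xs
  ⨆-attained [] = inj₁ refl
  ⨆-attained (y ∷ xs) with ℕₚ.⊔-sel (f y) (⨆ xs) | ⨆-attained xs
  ... | inj₁ fy⊔≡fy | _ = inj₂ (y , here refl , sym fy⊔≡fy)
  ... | inj₂ fy⊔≡⨆ | inj₁ ⨆≡0 = inj₁ (trans fy⊔≡⨆ ⨆≡0)
  ... | inj₂ fy⊔≡⨆ | inj₂ (x , x∈xs , fx≡⨆) = inj₂ (x , there x∈xs , trans fx≡⨆ (sym fy⊔≡⨆))

module _ {n} (G : SimpleGraph n) where

  α-upper : ∀ {S} → Independent G S → ∣ S ∣ ≤ α G
  α-upper {S} ind = ≤-⨆ ∣_∣ (∈-filterᵇ⁺ (isIndependent G) (∈-allSubsets S) (Independent⇒isIndependent G ind))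

  α-attained : ∃ λ S → Independent G S × ∣ S ∣ ≡ α G
  α-attained with ⨆-attained ∣_∣ (filterᵇ (isIndependent G) (allSubsets n))
  ... | inj₁ α≡0 = ⊥ₛ , (λ i∈⊥ → ⊥-elim (∉⊥ i∈⊥)) , trans (∣⊥∣≡0 n) (sym α≡0)
  ... | inj₂ (S , S∈ , ∣S∣≡α) =
    S , isIndependent⇒Independent G (proj₂ (∈-filterᵇ⁻ (isIndependent G) {xs = allSubsets n} S∈)) , ∣S∣≡α

-- The standard layering by size

module Standard {n} (G : SimpleGraph n) where

  private
    V : List (Subset n)
    V = verts (IAR G)

  down-degree : ∀ S → S ∈ V → 2 ≤ ∣ S ∣ →
                countᵇ (λ R → (∣ S △ R ∣ ≡ᵇ 1) ∧ (∣ R ∣ ≡ᵇ ∣ S ∣ ∸ 1)) V ≡ ∣ S ∣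
  down-degree S S∈V ∣S∣≥2 = ℕₚ.≤-antisym
    (subst (countᵇ below V ≤_) length-removals (countᵇ≤length below (IAR-unique G) below⇒removal))
    (subst (_≤ countᵇ below V) length-removals (length≤countᵇ below removals-unique removal⇒below))
    where
    below : Subset n → Bool
    below R = (∣ S △ R ∣ ≡ᵇ 1) ∧ (∣ R ∣ ≡ᵇ ∣ S ∣ ∸ 1)
    removals : List (Subset n)
    removals = List.map (S ∖_) (elements S)
    length-removals : length removals ≡ ∣ S ∣
    length-removals = trans (Listₚ.length-map (S ∖_) (elements S)) (length-elements S)
    removals-unique : Unique removals
    removals-unique = map-unique (elements-unique S) (λ i∈ _ → ∖-injective (∈-elements⁻ S i∈))
    below⇒removal : ∀ {R} → R ∈ V → below R ≡ true → R ∈ removals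
    below⇒removal {R} _ b with ∧≡true⁻ b
    ... | e , size with edge⇒Step S R e
    ... | remove i∈S refl = ∈-map⁺ (S ∖_) (∈-elements⁺ i∈S)
    ... | insert i∉S refl = ⊥-elim (suc≢∸1 ∣ S ∣ (trans (sym (∣S⊕i∣ S _ i∉S)) (≡ᵇ≡true⇒≡ size)))
    removal⇒below : ∀ {R} → R ∈ removals → R ∈ V × below R ≡ true
    removal⇒below R∈ with ∈-map⁻ (S ∖_) R∈
    ... | i , i∈ , refl with ∈-elements⁻ S i∈
    ... | i∈S with another-element i∈S ∣S∣≥2
    ... | j , j≢i , j∈S = ⊆-∈IAR G S∈V (S∖i⊆S S i) (∈-∖⁺ i j≢i j∈S) ,
          cong₂ _∧_ (Step⇒edge (remove i∈S refl)) (≡⇒≡ᵇ≡true (cong (_∸ 1) (∣S∖i∣ i∈S)))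

  common-down : ∀ U W → U ≢ W → ∣ U ∣ ≡ ∣ W ∣ →
                countᵇ (λ R → (∣ U △ R ∣ ≡ᵇ 1) ∧ (∣ W △ R ∣ ≡ᵇ 1) ∧ (∣ R ∣ ≡ᵇ ∣ U ∣ ∸ 1)) V ≤ 1
  common-down U W U≢W ∣U∣≡∣W∣ = countᵇ≤length common-below {ys = U ∩ W ∷ []} (IAR-unique G) (λ _ b → here (meet b))
    where
    common-below : Subset n → Bool
    common-below R = (∣ U △ R ∣ ≡ᵇ 1) ∧ (∣ W △ R ∣ ≡ᵇ 1) ∧ (∣ R ∣ ≡ᵇ ∣ U ∣ ∸ 1)
    meet : ∀ {R} → common-below R ≡ true → R ≡ U ∩ W
    meet {R} b with ∧≡true⁻ b
    ... | eU , b′ with ∧≡true⁻ b′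
    ... | eW , size with edge⇒Step U R eU | edge⇒Step W R eW
    ... | remove i∈U R≡U∖i | remove j∈W R≡W∖j =
          trans R≡U∖i (common-removal U≢W i∈U j∈W (trans (sym R≡U∖i) R≡W∖j))
    ... | insert i∉U refl | _ = ⊥-elim (suc≢∸1 ∣ U ∣ (trans (sym (∣S⊕i∣ U _ i∉U)) (≡ᵇ≡true⇒≡ size)))
    ... | remove _ _ | insert {j} j∉W R≡W⊕j = ⊥-elim (suc≢∸1 ∣ U ∣ (begin
          suc ∣ U ∣ ≡⟨ cong suc ∣U∣≡∣W∣ ⟩
          suc ∣ W ∣ ≡⟨ ∣S⊕i∣ W j j∉W ⟨
          ∣ W ⊕ j ∣ ≡⟨ cong ∣_∣ R≡W⊕j ⟨
          ∣ R ∣     ≡⟨ ≡ᵇ≡true⇒≡ size ⟩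
          ∣ U ∣ ∸ 1 ∎))
      where open ≡-Reasoning

  common-up : ∀ U W → U ≢ W → ∣ U ∣ ≡ ∣ W ∣ →
              countᵇ (λ R → (∣ U △ R ∣ ≡ᵇ 1) ∧ (∣ W △ R ∣ ≡ᵇ 1) ∧ (∣ R ∣ ≡ᵇ ∣ U ∣ + 1)) V ≤ 1
  common-up U W U≢W ∣U∣≡∣W∣ = countᵇ≤length common-above {ys = U ∪ W ∷ []} (IAR-unique G) (λ _ b → here (join b))
    where
    common-above : Subset n → Bool
    common-above R = (∣ U △ R ∣ ≡ᵇ 1) ∧ (∣ W △ R ∣ ≡ᵇ 1) ∧ (∣ R ∣ ≡ᵇ ∣ U ∣ + 1)
    not-below : ∀ {r s} → suc r ≡ s → r ≢ s + 1
    not-below {r} 1+r≡s r≡s+1 = ℕₚ.m≢1+m+n r (trans r≡s+1 (cong (_+ 1) (sym 1+r≡s)))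
    join : ∀ {R} → common-above R ≡ true → R ≡ U ∪ W
    join {R} b with ∧≡true⁻ b
    ... | eU , b′ with ∧≡true⁻ b′
    ... | eW , size with edge⇒Step U R eU | edge⇒Step W R eW
    ... | insert i∉U R≡U⊕i | insert j∉W R≡W⊕j =
          trans R≡U⊕i (common-insertion U≢W i∉U j∉W (trans (sym R≡U⊕i) R≡W⊕j))
    ... | remove i∈U refl | _ = ⊥-elim (not-below (∣S∖i∣ i∈U) (≡ᵇ≡true⇒≡ size))
    ... | insert _ _ | remove j∈W R≡W∖j = ⊥-elim (not-below
          (trans (cong (suc ∘ ∣_∣) R≡W∖j) (trans (∣S∖i∣ j∈W) (sym ∣U∣≡∣W∣))) (≡ᵇ≡true⇒≡ size))

  layer-nonempty : ∀ k → 1 ≤ k → k ≤ α G → Σ (Subset n) λ S → S ∈ V × ∣ S ∣ ≡ k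
  layer-nonempty k 1≤k k≤α with α-attained G
  ... | S , S-ind , ∣S∣≡α with subset-of-size S k (subst (k ≤_) (sym ∣S∣≡α) k≤α)
  ... | R , R⊆S , ∣R∣≡k with ∣S∣>0⇒nonempty R (subst (0 <_) (sym ∣R∣≡k) 1≤k)
  ... | i , i∈R = R , ∈IAR⁺ G (λ i∈ j∈ → S-ind (R⊆S i∈) (R⊆S j∈)) (i , i∈R) , ∣R∣≡k

  isLayering : IsLayering (IAR G) (α G) ∣_∣
  isLayering = record
    { label-range = λ S S∈V → let S-ind , _ , i∈S = ∈IAR⁻ G S∈V in i∈S⇒∣S∣>0 i∈S , α-upper G S-ind
    ; layer-nonempty = layer-nonempty
    ; layer-indep = λ S R _ _ ∣S∣≡∣R∣ → Boolₚ.¬-not λ e → OneApart⇒≢ (Step-size (edge⇒Step S R e)) ∣S∣≡∣R∣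
    ; adjacent-layers = λ S R _ _ e → OneApart⇒+1 (Step-size (edge⇒Step S R e))
    ; down-degree = down-degree
    ; common-down = λ U W _ _ → common-down U W
    ; common-up = λ U W _ _ → common-up U W
    }

-- Components that are even cycles

record TwoNeighbours {A : Set} (X : FinGraph A) (v : A) : Set where
  field
    left right : A
    left≢right : left ≢ right
    left∈X : left ∈ verts X
    right∈X : right ∈ verts X
    v-left : E X v left ≡ true
    v-right : E X v right ≡ true
    only : ∀ {u} → u ∈ verts X → E X v u ≡ true → u ≡ left ⊎ u ≡ right

reach-∈ : ∀ {A : Set} {X : FinGraph A} {v₀ v} → v₀ ∈ verts X → Reach X v₀ v → v ∈ verts X
reach-∈ v₀∈X here = v₀∈X
reach-∈ _ (step _ v∈X _) = v∈X

-- The component of v₀ is traced by the non-backtracking walk from v₀; its first repetition closes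
-- a cycle through v₀, which is the whole component, and h changes parity at every step.
module EvenCycle {A : Set} (_≟_ : DecidableEquality A) (X : FinGraph A)
                 (E-sym : ∀ u v → E X u v ≡ E X v u)
                 (h : A → ℕ) (h-step : ∀ {u v} → E X u v ≡ true → OneApart (h u) (h v))
                 {v₀ : A} (v₀∈X : v₀ ∈ verts X) (two : ∀ {v} → Reach X v₀ v → TwoNeighbours X v) where

  open TwoNeighbours

  private
    Adj : A → A → Set
    Adj u v = E X u v ≡ true

    Reachable : A → Set
    Reachable = Reach X v₀

  adj-sym : ∀ {u v} → Adj u v → Adj v u
  adj-sym {u} {v} uv = trans (E-sym v u) uv

  ¬adj-self : ∀ {v} → ¬ Adj v v
  ¬adj-self vv = OneApart⇒≢ (h-step vv) refl

  other : ∀ {v} → Reachable v → A → Σ A λ w → w ∈ verts X × Adj v w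
  other r u with left (two r) ≟ u
  ... | yes _ = right (two r) , right∈X (two r) , v-right (two r)
  ... | no _ = left (two r) , left∈X (two r) , v-left (two r)

  other-spec : ∀ {v u} (r : Reachable v) → u ∈ verts X → Adj v u →
               proj₁ (other r u) ≢ u × (∀ {x} → x ∈ verts X → Adj v x → x ≡ u ⊎ x ≡ proj₁ (other r u))
  other-spec {u = u} r u∈X vu with left (two r) ≟ u
  ... | yes refl = left≢right (two r) ∘ sym , only (two r)
  ... | no left≢u = left≢u , λ x∈X vx → [ inj₂ , (λ x≡right → inj₁ (trans x≡right right≡u)) ]′ (only (two r) x∈X vx)
    where
    right≡u : right (two r) ≡ u
    right≡u = [ ⊥-elim ∘ left≢u ∘ sym , sym ]′ (only (two r) u∈X vu)

  walk : ℕ → Σ A Reachable × Σ A Reachable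
  walk zero = (v₀ , here) , (left (two here) , step here (left∈X (two here)) (v-left (two here)))
  walk (suc k) = let (u , _) , (v , r) = walk k ; w , w∈X , vw = other r u in (v , r) , (w , step r w∈X vw)

  w : ℕ → A
  w k = proj₁ (proj₁ (walk k))

  w-reach : ∀ k → Reachable (w k)
  w-reach k = proj₂ (proj₁ (walk k))

  w-∈ : ∀ k → w k ∈ verts X
  w-∈ k = reach-∈ v₀∈X (w-reach k)

  w-adj : ∀ k → Adj (w k) (w (suc k))
  w-adj zero = v-left (two here)
  w-adj (suc k) = proj₂ (proj₂ (other (w-reach (suc k)) (w k)))

  w-turn : ∀ k → w (suc (suc k)) ≢ w k × (∀ {x} → x ∈ verts X → Adj (w (suc k)) x → x ≡ w k ⊎ x ≡ w (suc (suc k)))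
  w-turn k = other-spec (w-reach (suc k)) (w-∈ k) (adj-sym (w-adj k))

  Repeats : ℕ → Set
  Repeats j = ∃ λ i → i < j × w i ≡ w j

  some-repeat : ∃ Repeats
  some-repeat with Finₚ.pigeonhole (ℕₚ.n<1+n (length (verts X))) (λ k → index (w-∈ (toℕ k)))
  ... | i , j , i<j , same-index = toℕ j , toℕ i , i<j , (begin
    w (toℕ i)                                  ≡⟨ lookup-index (w-∈ (toℕ i)) ⟩
    List.lookup (verts X) (index (w-∈ (toℕ i))) ≡⟨ cong (List.lookup (verts X)) same-index ⟩
    List.lookup (verts X) (index (w-∈ (toℕ j))) ≡⟨ lookup-index (w-∈ (toℕ j)) ⟨
    w (toℕ j)                                  ∎)
    where open ≡-Reasoning

  first-repeat : Least Repeats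
  first-repeat = least-witness (λ j → ℕₚ.anyUpTo? (λ i → w i ≟ w j) j) (proj₂ some-repeat)

  parity : ∀ k → 2 ∣ h (w k) + k + h v₀
  parity zero = subst (2 ∣_) (cong (_+ h v₀) (sym (ℕₚ.+-identityʳ (h v₀)))) (2∣m+m (h v₀))
  parity (suc k) with h-step (w-adj k)
  ... | inj₁ h′≡1+h = subst (λ m → 2 ∣ m + suc k + h v₀) (sym h′≡1+h)
                        (subst (2 ∣_) (cong (λ m → suc (m + h v₀)) (sym (ℕₚ.+-suc (h (w k)) k)))
                          (∣m∣n⇒∣m+n (∣-refl {2}) (parity k)))
  ... | inj₂ h≡1+h′ = subst (2 ∣_) (trans (cong (λ m → m + k + h v₀) h≡1+h′)
                                          (cong (_+ h v₀) (sym (ℕₚ.+-suc (h (w (suc k))) k))))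
                        (parity k)

  module FirstRepeat (K : ℕ) (repeat : Repeats K) (no-earlier : ∀ {j} → j < K → ¬ Repeats j) where

    w-injective : ∀ {i j} → i < K → j < K → w i ≡ w j → i ≡ j
    w-injective {i} {j} i<K j<K wi≡wj with ℕₚ.<-cmp i j
    ... | tri< i<j _ _ = ⊥-elim (no-earlier j<K (i , i<j , wi≡wj))
    ... | tri≈ _ i≡j _ = i≡j
    ... | tri> _ _ j<i = ⊥-elim (no-earlier i<K (j , j<i , sym wi≡wj))

    K′ : ℕ
    K′ = K ∸ 1

    1+K′≡K : suc K′ ≡ K
    1+K′≡K = suc-∸1 (ℕₚ.≤-trans (s≤s z≤n) (proj₁ (proj₂ repeat)))

    K′<K : K′ < K
    K′<K = subst (K′ <_) 1+K′≡K (ℕₚ.n<1+n K′)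

    wK′-adj-wK : Adj (w K′) (w K)
    wK′-adj-wK = subst (λ m → Adj (w K′) (w m)) 1+K′≡K (w-adj K′)

    -- If the first repetition were w (suc i) = w K, the predecessor w K′ of w K would be one of the
    -- two walk neighbours of w (suc i), and either choice gives an earlier repetition.
    returns-to-start : ∀ {i} → i < K → w i ≡ w K → i ≡ 0
    returns-to-start {zero} _ _ = refl
    returns-to-start {suc i} 1+i<K w1+i≡wK =
      ⊥-elim ([ earlier-i , earlier-2+i ]′
        (proj₂ (w-turn i) (w-∈ K′) (subst (λ x → Adj x (w K′)) (sym w1+i≡wK) (adj-sym wK′-adj-wK))))
      where
      i<K′ : i < K′
      i<K′ = ℕₚ.≤-pred (subst (suc (suc i) ≤_) (sym 1+K′≡K) 1+i<K)
      earlier-i : w K′ ≡ w i → ⊥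
      earlier-i wK′≡wi = no-earlier K′<K (i , i<K′ , sym wK′≡wi)
      earlier-2+i : w K′ ≡ w (suc (suc i)) → ⊥
      earlier-2+i wK′≡w2+i with ℕₚ.<-cmp (suc (suc i)) K′
      ... | tri< 2+i<K′ _ _ = no-earlier K′<K (suc (suc i) , 2+i<K′ , sym wK′≡w2+i)
      ... | tri≈ _ 2+i≡K′ _ =
            proj₁ (w-turn (suc i)) (trans (cong (w ∘ suc) 2+i≡K′) (trans (cong w 1+K′≡K) (sym w1+i≡wK)))
      ... | tri> _ _ K′<2+i = ¬adj-self (subst (λ x → Adj x (w K)) (trans (cong w K′≡1+i) w1+i≡wK) wK′-adj-wK)
        where
        K′≡1+i : K′ ≡ suc i
        K′≡1+i = ℕₚ.≤-antisym (ℕₚ.≤-pred K′<2+i) i<K′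

    closes : w K ≡ v₀
    closes = let i , i<K , wi≡wK = repeat in
      sym (subst (λ j → w j ≡ w K) (returns-to-start i<K wi≡wK) wi≡wK)

    K≥3 : 3 ≤ K
    K≥3 = at-least-3 K refl
      where
      at-least-3 : ∀ k → K ≡ k → 3 ≤ k
      at-least-3 0 K≡0 = ⊥-elim (ℕₚ.n≮0 (subst (K′ <_) K≡0 K′<K))
      at-least-3 1 K≡1 = ⊥-elim (¬adj-self (subst (Adj v₀) (trans (cong w (sym K≡1)) closes) (w-adj 0)))
      at-least-3 2 K≡2 = ⊥-elim (proj₁ (w-turn 0) (trans (cong w (sym K≡2)) closes))
      at-least-3 (suc (suc (suc k))) _ = s≤s (s≤s (s≤s z≤n))

    2∣K : 2 ∣ K
    2∣K = ∣m+n∣m⇒∣n (subst (2 ∣_) rearranged (parity K)) (2∣m+m (h v₀))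
      where
      open ≡-Reasoning
      rearranged : h (w K) + K + h v₀ ≡ h v₀ + h v₀ + K
      rearranged = begin
        h (w K) + K + h v₀   ≡⟨ cong (λ x → h x + K + h v₀) closes ⟩
        h v₀ + K + h v₀      ≡⟨ ℕₚ.+-assoc (h v₀) K (h v₀) ⟩
        h v₀ + (K + h v₀)    ≡⟨ cong (h v₀ +_) (ℕₚ.+-comm K (h v₀)) ⟩
        h v₀ + (h v₀ + K)    ≡⟨ ℕₚ.+-assoc (h v₀) (h v₀) K ⟨
        h v₀ + h v₀ + K      ∎

    cycle : Fin K → A
    cycle j = w (toℕ j)

    cycle-injective : ∀ i j → cycle i ≡ cycle j → i ≡ j
    cycle-injective i j ci≡cj = Finₚ.toℕ-injective (w-injective (Finₚ.toℕ<n i) (Finₚ.toℕ<n j) ci≡cj)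

    position : ∀ {m} → m < K → Σ (Fin K) λ j → toℕ j ≡ m
    position m<K = fromℕ< m<K , Finₚ.toℕ-fromℕ< m<K

    Succ : ℕ → ℕ → Set
    Succ m j = j ≡ suc m ⊎ (suc m ≡ K × j ≡ 0)

    wK′≡right : w K′ ≡ right (two here)
    wK′≡right = [ (λ wK′≡w1 → ⊥-elim (K′≢1 (w-injective K′<K 1<K wK′≡w1))) , id ]′
                  (only (two here) (w-∈ K′) (subst (λ x → Adj x (w K′)) closes (adj-sym wK′-adj-wK)))
      where
      1<K : 1 < K
      1<K = ℕₚ.≤-trans (s≤s (s≤s z≤n)) K≥3
      K′≢1 : K′ ≢ 1
      K′≢1 K′≡1 = ℕₚ.<⇒≱ K≥3 (ℕₚ.≤-reflexive (trans (sym 1+K′≡K) (cong suc K′≡1)))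

    neighbour-position : ∀ {m} → m < K → ∀ {u} → u ∈ verts X → Adj (w m) u →
                         ∃ λ j → cycle j ≡ u × (Succ m (toℕ j) ⊎ Succ (toℕ j) m)
    neighbour-position {zero} 0<K u∈X v₀u with only (two here) u∈X v₀u
    ... | inj₁ refl = let j , j≡1 = position (ℕₚ.≤-trans (s≤s (s≤s z≤n)) K≥3) in
                      j , cong w j≡1 , inj₁ (inj₁ j≡1)
    ... | inj₂ refl = let j , j≡K′ = position K′<K in
                      j , trans (cong w j≡K′) wK′≡right , inj₂ (inj₂ (trans (cong suc j≡K′) 1+K′≡K , refl))
    neighbour-position {suc m} 1+m<K u∈X wu with proj₂ (w-turn m) u∈X wu
    ... | inj₁ refl = let j , j≡m = position (ℕₚ.<-trans (ℕₚ.n<1+n m) 1+m<K) in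
                      j , cong w j≡m , inj₂ (inj₁ (cong suc (sym j≡m)))
    ... | inj₂ refl with ℕₚ.m≤n⇒m<n∨m≡n 1+m<K
    ...   | inj₁ 2+m<K = let j , j≡2+m = position 2+m<K in j , cong w j≡2+m , inj₁ (inj₁ j≡2+m)
    ...   | inj₂ 2+m≡K = let j , j≡0 = position (ℕₚ.≤-trans (s≤s z≤n) K≥3) in
                         j , trans (cong w j≡0) (trans (sym closes) (cong w (sym 2+m≡K))) ,
                         inj₁ (inj₂ (2+m≡K , j≡0))

    reach⇔cycle : ∀ u → (Reachable u ⇔ ∃ λ j → cycle j ≡ u)
    reach⇔cycle u = mk⇔ on-cycle (λ (j , cj≡u) → subst Reachable cj≡u (w-reach (toℕ j)))
      where
      on-cycle : ∀ {u} → Reachable u → ∃ λ j → cycle j ≡ u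
      on-cycle here = let j , j≡0 = position (ℕₚ.≤-trans (s≤s z≤n) K≥3) in j , cong w j≡0
      on-cycle (step {v} {u} v-reach u∈X vu) with on-cycle v-reach
      ... | j , cj≡v with neighbour-position (Finₚ.toℕ<n j) u∈X (subst (λ x → Adj x u) (sym cj≡v) vu)
      ...   | j′ , cj′≡u , _ = j′ , cj′≡u

    successor-adjacent : ∀ i j → CyclicSucc K i j → Adj (cycle i) (cycle j)
    successor-adjacent i j (inj₁ j≡1+i) = subst (λ m → Adj (cycle i) (w m)) (sym j≡1+i) (w-adj (toℕ i))
    successor-adjacent i j (inj₂ (1+i≡K , j≡0)) =
      subst (Adj (cycle i)) (trans (cong w 1+i≡K) (trans closes (cong w (sym j≡0)))) (w-adj (toℕ i))

    adjacent⇔successor : ∀ i j → (Adj (cycle i) (cycle j) ⇔ (CyclicSucc K i j ⊎ CyclicSucc K j i))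
    adjacent⇔successor i j = mk⇔ successor [ successor-adjacent i j , adj-sym ∘ successor-adjacent j i ]′
      where
      successor : Adj (cycle i) (cycle j) → CyclicSucc K i j ⊎ CyclicSucc K j i
      successor ci-cj with neighbour-position (Finₚ.toℕ<n i) (w-∈ (toℕ j)) ci-cj
      ... | j′ , cj′≡cj , rel with cycle-injective j′ j cj′≡cj
      ...   | refl = rel

    isEvenCycle : ComponentIsEvenCycle X v₀
    isEvenCycle = K , K≥3 , 2∣K , cycle , cycle-injective , reach⇔cycle , adjacent⇔successor

  componentIsEvenCycle : ComponentIsEvenCycle X v₀
  componentIsEvenCycle = let K , repeat , no-earlier = first-repeat in FirstRepeat.isEvenCycle K repeat no-earlier

-- An arbitrary layering of I¹_AR(G)

module Layering {n} (G : SimpleGraph n) {p} {f : Subset n → ℕ} (L : IsLayering (IAR G) p f) where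

  open IsLayering L

  private
    V : List (Subset n)
    V = verts (IAR G)
    open DecMembership (Vecₚ.≡-dec {n = n} Boolₚ._≟_) using () renaming (_∈?_ to _∈V?_)

  label≥1 : ∀ {S} → S ∈ V → 1 ≤ f S
  label≥1 {S} S∈V = proj₁ (label-range S S∈V)

  label-step : ∀ {S R} → S ∈ V → R ∈ V → Step S R → OneApart (f S) (f R)
  label-step {S} {R} S∈V R∈V st with adjacent-layers S R S∈V R∈V (Step⇒edge st)
  ... | inj₁ fR≡fS+1 = inj₁ (trans fR≡fS+1 (ℕₚ.+-comm (f S) 1))
  ... | inj₂ fS≡fR+1 = inj₂ (trans fS≡fR+1 (ℕₚ.+-comm (f R) 1))

  ∖-∈V : ∀ {S i j} → S ∈ V → j ≢ i → j ∈ₛ S → S ∖ i ∈ V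
  ∖-∈V {S} {i} S∈V j≢i j∈S = ⊆-∈IAR G S∈V (S∖i⊆S S i) (∈-∖⁺ i j≢i j∈S)

  two-satisfiers : ∀ (q : Subset n → Bool) {X Y} → X ≢ Y → X ∈ V → Y ∈ V → q X ≡ true → q Y ≡ true →
                   2 ≤ countᵇ q V
  two-satisfiers q X≢Y X∈V Y∈V qX qY =
    length≤countᵇ q ((X≢Y All.∷ All.[]) ∷ All.[] ∷ AllPairs.[]) λ where
      (here refl) → X∈V , qX
      (there (here refl)) → Y∈V , qY

  no-two-common-neighbours : ∀ {U W X Y} → U ∈ V → W ∈ V → X ∈ V → Y ∈ V → U ≢ W → X ≢ Y →
                             Step U X → Step W X → Step U Y → Step W Y →
                             f U ≡ f W → f X ≡ f Y → ⊥
  no-two-common-neighbours {U} {W} {X} {Y} U∈V W∈V X∈V Y∈V U≢W X≢Y UX WX UY WY fU≡fW fX≡fY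
    with label-step U∈V X∈V UX
  ... | inj₁ fX≡1+fU = ℕₚ.<⇒≱ (two-satisfiers common-above X≢Y X∈V Y∈V (is-above X UX WX fX≡1+fU)
                         (is-above Y UY WY (trans (sym fX≡fY) fX≡1+fU))) (common-up U W U∈V W∈V U≢W fU≡fW)
    where
    common-above : Subset n → Bool
    common-above Z = E (IAR G) U Z ∧ E (IAR G) W Z ∧ (f Z ≡ᵇ f U + 1)
    is-above : ∀ Z → Step U Z → Step W Z → f Z ≡ suc (f U) → common-above Z ≡ true
    is-above Z UZ WZ fZ≡1+fU =
      cong₂ _∧_ (Step⇒edge UZ) (cong₂ _∧_ (Step⇒edge WZ) (≡⇒≡ᵇ≡true (trans fZ≡1+fU (ℕₚ.+-comm 1 (f U)))))
  ... | inj₂ fU≡1+fX = ℕₚ.<⇒≱ (two-satisfiers common-below X≢Y X∈V Y∈V (is-below X UX WX refl)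
                         (is-below Y UY WY (sym fX≡fY))) (common-down U W U∈V W∈V U≢W fU≡fW)
    where
    common-below : Subset n → Bool
    common-below Z = E (IAR G) U Z ∧ E (IAR G) W Z ∧ (f Z ≡ᵇ f U ∸ 1)
    is-below : ∀ Z → Step U Z → Step W Z → f Z ≡ f X → common-below Z ≡ true
    is-below Z UZ WZ fZ≡fX =
      cong₂ _∧_ (Step⇒edge UZ) (cong₂ _∧_ (Step⇒edge WZ) (≡⇒≡ᵇ≡true (trans fZ≡fX (cong (_∸ 1) (sym fU≡1+fX)))))

  -- The 4-cycle S, S ∖ y, S ∖ y ∖ z, S ∖ z cannot have S ∖ y and S ∖ z on one layer and
  -- S, S ∖ y ∖ z on another, by condition (4); so labels add up across the square.
  square : ∀ {S y z} → S ∈ V → y ∈ₛ S → z ∈ₛ S → y ≢ z → S ∖ y ∖ z ∈ V →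
           f S + f (S ∖ y ∖ z) ≡ f (S ∖ y) + f (S ∖ z)
  square {S} {y} {z} S∈V y∈S z∈S y≢z D∈V =
    [ id , (λ (fB≡fC , fS≡fD) → ⊥-elim (no-two-common-neighbours B∈V C∈V S∈V D∈V B≢C S≢D
                                          (Step-sym S→B) (Step-sym S→C) B→D C→D fB≡fC fS≡fD)) ]′
    (square-arith (label-step S∈V B∈V S→B) (label-step S∈V C∈V S→C)
                  (label-step B∈V D∈V B→D) (label-step C∈V D∈V C→D))
    where
    z≢y : z ≢ y
    z≢y = y≢z ∘ sym
    B∈V : S ∖ y ∈ V
    B∈V = ∖-∈V S∈V z≢y z∈S
    C∈V : S ∖ z ∈ V
    C∈V = ∖-∈V S∈V y≢z y∈S
    S→B : Step S (S ∖ y)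
    S→B = remove y∈S refl
    S→C : Step S (S ∖ z)
    S→C = remove z∈S refl
    B→D : Step (S ∖ y) (S ∖ y ∖ z)
    B→D = remove (∈-∖⁺ y z≢y z∈S) refl
    C→D : Step (S ∖ z) (S ∖ y ∖ z)
    C→D = remove (∈-∖⁺ z y≢z y∈S) (∖-comm S y z)
    B≢C : S ∖ y ≢ S ∖ z
    B≢C B≡C = i∉S∖i S y (subst (y ∈ₛ_) (sym B≡C) (∈-∖⁺ z y≢z y∈S))
    S≢D : S ≢ S ∖ y ∖ z
    S≢D S≡D = i∉S∖i S y (S∖i⊆S (S ∖ y) z (subst (y ∈ₛ_) S≡D y∈S))

  below : Subset n → Subset n → Bool
  below T u = E (IAR G) T u ∧ (f u ≡ᵇ f T ∸ 1)

  module Anchored {a} (fa≡1 : f ⁅ a ⁆ ≡ 1) where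

    Labelled-by-size : ℕ → Set
    Labelled-by-size k = ∀ {S} → ∣ S ∣ ≡ k → S ∈ V → a ∈ₛ S → f S ≡ k

    labelled-by-size-2 : Labelled-by-size 1 → Labelled-by-size 2
    labelled-by-size-2 IH₁ {S} ∣S∣≡2 S∈V a∈S with another-element a∈S (ℕₚ.≤-reflexive (sym ∣S∣≡2))
    ... | y , y≢a , y∈S = above-1 (label-step S∈V B∈V (remove y∈S refl))
      where
      B∈V : S ∖ y ∈ V
      B∈V = ∖-∈V S∈V (y≢a ∘ sym) a∈S
      fB≡1 : f (S ∖ y) ≡ 1
      fB≡1 = IH₁ (ℕₚ.suc-injective (trans (∣S∖i∣ y∈S) ∣S∣≡2)) B∈V (∈-∖⁺ y (y≢a ∘ sym) a∈S)
      above-1 : OneApart (f S) (f (S ∖ y)) → f S ≡ 2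
      above-1 (inj₁ fB≡1+fS) = ⊥-elim (ℕₚ.<⇒≢ (s≤s (label≥1 S∈V)) (trans (sym fB≡1) fB≡1+fS))
      above-1 (inj₂ fS≡1+fB) = trans fS≡1+fB (cong suc fB≡1)

    labelled-by-size-3+ : ∀ k → Labelled-by-size (suc k) → Labelled-by-size (suc (suc k)) →
                          Labelled-by-size (suc (suc (suc k)))
    labelled-by-size-3+ k IH₁ IH₂ {S} ∣S∣≡3+k S∈V a∈S
      with two-other-elements a∈S (subst (3 ≤_) (sym ∣S∣≡3+k) (s≤s (s≤s (s≤s z≤n))))
    ... | y , z , y≢a , z≢a , y≢z , y∈S , z∈S = ℕₚ.+-cancelʳ-≡ (suc k) (f S) (suc (suc (suc k))) (begin
      f S + suc k                 ≡⟨ cong (f S +_) fD ⟨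
      f S + f (S ∖ y ∖ z)         ≡⟨ square S∈V y∈S z∈S y≢z D∈V ⟩
      f (S ∖ y) + f (S ∖ z)       ≡⟨ cong₂ _+_ fB fC ⟩
      suc (suc k) + suc (suc k)   ≡⟨ cong (λ m → suc (suc m)) (ℕₚ.+-suc k (suc k)) ⟩
      suc (suc (suc k)) + suc k   ∎)
      where
      open ≡-Reasoning
      a∈B : a ∈ₛ S ∖ y
      a∈B = ∈-∖⁺ y (y≢a ∘ sym) a∈S
      z∈B : z ∈ₛ S ∖ y
      z∈B = ∈-∖⁺ y (y≢z ∘ sym) z∈S
      ∣B∣≡2+k : ∣ S ∖ y ∣ ≡ suc (suc k)
      ∣B∣≡2+k = ℕₚ.suc-injective (trans (∣S∖i∣ y∈S) ∣S∣≡3+k)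
      D∈V : S ∖ y ∖ z ∈ V
      D∈V = ∖-∈V (∖-∈V S∈V (y≢a ∘ sym) a∈S) (z≢a ∘ sym) a∈B
      fB : f (S ∖ y) ≡ suc (suc k)
      fB = IH₂ ∣B∣≡2+k (∖-∈V S∈V (y≢a ∘ sym) a∈S) a∈B
      fC : f (S ∖ z) ≡ suc (suc k)
      fC = IH₂ (ℕₚ.suc-injective (trans (∣S∖i∣ z∈S) ∣S∣≡3+k)) (∖-∈V S∈V (z≢a ∘ sym) a∈S) (∈-∖⁺ z (z≢a ∘ sym) a∈S)
      fD : f (S ∖ y ∖ z) ≡ suc k
      fD = IH₁ (ℕₚ.suc-injective (trans (∣S∖i∣ z∈B) ∣B∣≡2+k)) D∈V (∈-∖⁺ z (z≢a ∘ sym) a∈B)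

    labelled-by-size : ∀ k → Labelled-by-size k
    labelled-by-size zero ∣S∣≡0 _ a∈S = ⊥-elim (∣S∣≡0⇒∉ ∣S∣≡0 a∈S)
    labelled-by-size 1 ∣S∣≡1 _ a∈S = trans (cong f (∣S∣≡1⇒S≡⁅i⁆ a∈S ∣S∣≡1)) fa≡1
    labelled-by-size 2 = labelled-by-size-2 (labelled-by-size 1)
    labelled-by-size (suc (suc (suc k))) =
      labelled-by-size-3+ k (labelled-by-size (suc k)) (labelled-by-size (suc (suc k)))

    anchored : ∀ {S} → S ∈ V → a ∈ₛ S → f S ≡ ∣ S ∣
    anchored S∈V a∈S = labelled-by-size _ refl S∈V a∈S

    -- The two lower neighbours of ⁅ a ⁆ ⊕ x (label 2) can only be ⁅ a ⁆ and ⁅ x ⁆.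
    spread : ∀ {x} → x ≢ a → ⁅ a ⁆ ⊕ x ∈ V → f ⁅ x ⁆ ≡ 1
    spread {x} x≢a P∈V with f ⁅ x ⁆ ℕₚ.≟ 1
    ... | yes fx≡1 = fx≡1
    ... | no fx≢1 = ⊥-elim (ℕₚ.<⇒≱ 2≤count
          (countᵇ≤length (below P) {ys = ⁅ a ⁆ ∷ []} (IAR-unique G) (λ u∈V b → here (only-⁅a⁆ u∈V b))))
      where
      P : Subset n
      P = ⁅ a ⁆ ⊕ x
      a∈P : a ∈ₛ P
      a∈P = ∈-⊕⁺ x (x∈⁅x⁆ a)
      x∈P : x ∈ₛ P
      x∈P = i∈S⊕i ⁅ a ⁆ x
      ∣P∣≡2 : ∣ P ∣ ≡ 2
      ∣P∣≡2 = trans (∣S⊕i∣ ⁅ a ⁆ x (x≢a ∘ x∈⁅y⁆⇒x≡y a)) (cong suc (∣⁅x⁆∣≡1 a))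
      fP≡2 : f P ≡ 2
      fP≡2 = trans (anchored P∈V a∈P) ∣P∣≡2
      2≤count : 2 ≤ countᵇ (below P) V
      2≤count = ℕₚ.≤-reflexive (sym (trans (down-degree P P∈V (ℕₚ.≤-reflexive (sym fP≡2))) fP≡2))
      only-⁅a⁆ : ∀ {u} → u ∈ V → below P u ≡ true → u ≡ ⁅ a ⁆
      only-⁅a⁆ {u} u∈V b with ∧≡true⁻ b
      ... | e , level with edge⇒Step P u e
      ... | insert {i} i∉P refl
        with () ← trans (sym (trans (anchored u∈V (∈-⊕⁺ i a∈P)) (trans (∣S⊕i∣ P i i∉P) (cong suc ∣P∣≡2))))
                        (trans (≡ᵇ≡true⇒≡ level) (cong (_∸ 1) fP≡2))
      ... | remove {i} i∈P refl with ∈-⊕⁻ ⁅ a ⁆ x i∈P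
      ...   | inj₁ refl = ∣S∣≡1⇒S≡⁅i⁆ (∈-∖⁺ x (x≢a ∘ sym) a∈P) (ℕₚ.suc-injective (trans (∣S∖i∣ x∈P) ∣P∣≡2))
      ...   | inj₂ i∈⁅a⁆ with refl ← x∈⁅y⁆⇒x≡y a i∈⁅a⁆ = ⊥-elim (fx≢1 (begin
              f ⁅ x ⁆   ≡⟨ cong f (∣S∣≡1⇒S≡⁅i⁆ (∈-∖⁺ a x≢a x∈P) (ℕₚ.suc-injective (trans (∣S∖i∣ a∈P) ∣P∣≡2))) ⟨
              f (P ∖ a) ≡⟨ ≡ᵇ≡true⇒≡ level ⟩
              f P ∸ 1   ≡⟨ cong (_∸ 1) fP≡2 ⟩
              1         ∎))
        where open ≡-Reasoning

  Unanchored : Subset n → Set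
  Unanchored S = ∀ {a} → a ∈ₛ S → f ⁅ a ⁆ ≢ 1

  Step-unanchored : ∀ {S R} → S ∈ V → R ∈ V → Step S R → Unanchored S → Unanchored R
  Step-unanchored _ _ (remove i∈S refl) S-unanchored a∈R = S-unanchored (S∖i⊆S _ _ a∈R)
  Step-unanchored {S} S∈V R∈V (insert {i} i∉S refl) S-unanchored a∈R with ∈-⊕⁻ S i a∈R
  ... | inj₂ a∈S = S-unanchored a∈S
  ... | inj₁ refl with proj₂ (∈IAR⁻ G S∈V)
  ...   | b , b∈S = λ fi≡1 → S-unanchored b∈S (Anchored.spread fi≡1 b≢i
                      (⊆-∈IAR G R∈V (⁅i⁆⊕j⊆S (i∈S⊕i S i) (∈-⊕⁺ i b∈S)) (i∈S⊕i ⁅ i ⁆ b)))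
    where
    b≢i : b ≢ i
    b≢i refl = i∉S b∈S

  Lowering : Subset n → Fin n → Set
  Lowering B y = y ∈ₛ B × suc (f (B ∖ y)) ≡ f B

  lowering-commutes : ∀ {T z y} → T ∈ V → z ≢ y → Nonempty (T ∖ z ∖ y) →
                      Lowering T z → Lowering T y → Lowering (T ∖ z) y
  lowering-commutes {T} {z} {y} T∈V z≢y (j , j∈) (z∈T , Lz) (y∈T , Ly) =
    y∈T∖z , ℕₚ.+-cancelˡ-≡ (f (T ∖ z)) _ _ (begin
      f (T ∖ z) + suc (f (T ∖ z ∖ y)) ≡⟨ ℕₚ.+-suc (f (T ∖ z)) _ ⟩
      suc (f (T ∖ z)) + f (T ∖ z ∖ y) ≡⟨ cong (_+ f (T ∖ z ∖ y)) Lz ⟩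
      f T + f (T ∖ z ∖ y)             ≡⟨ square T∈V z∈T y∈T z≢y (⊆-∈IAR G T∈V (S∖i⊆S T z ∘ S∖i⊆S (T ∖ z) y) j∈) ⟩
      f (T ∖ z) + f (T ∖ y)           ≡⟨ cong (f (T ∖ z) +_) (ℕₚ.suc-injective (trans Ly (sym Lz))) ⟩
      f (T ∖ z) + f (T ∖ z)           ∎)
    where
    open ≡-Reasoning
    y∈T∖z : y ∈ₛ T ∖ z
    y∈T∖z = ∈-∖⁺ z (z≢y ∘ sym) y∈T

  module _ {B} (B∈V : B ∈ V) where

    descent : ∀ {ys} → Unique ys → All (Lowering B) ys → Nonempty (B ∖∗ ys) →
              f (B ∖∗ ys) + length ys ≡ f B ×
              (∀ {y} → Lowering B y → y ∉ ys → Nonempty (B ∖∗ ys ∖ y) → Lowering (B ∖∗ ys) y)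
    descent {[]} _ _ _ = ℕₚ.+-identityʳ (f B) , λ Ly _ _ → Ly
    descent {z ∷ zs} (z∉zs ∷ zs!) (Lz All.∷ Lzs) (j , j∈) = lowered , still-lowering
      where
      C : Subset n
      C = B ∖∗ zs
      IH : f C + length zs ≡ f B × (∀ {y} → Lowering B y → y ∉ zs → Nonempty (C ∖ y) → Lowering C y)
      IH = descent zs! Lzs (j , S∖i⊆S C z j∈)
      LTz : Lowering C z
      LTz = proj₂ IH Lz (λ z∈zs → All.lookup z∉zs z∈zs refl) (j , j∈)
      lowered : f (C ∖ z) + suc (length zs) ≡ f B
      lowered = trans (ℕₚ.+-suc (f (C ∖ z)) (length zs)) (trans (cong (_+ length zs) (proj₂ LTz)) (proj₁ IH))
      still-lowering : ∀ {y} → Lowering B y → y ∉ z ∷ zs → Nonempty (C ∖ z ∖ y) → Lowering (C ∖ z) y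
      still-lowering {y} Ly y∉ (k , k∈) =
        lowering-commutes (⊆-∈IAR G B∈V (∖∗-⊆ B zs) (S∖i⊆S C z (S∖i⊆S (C ∖ z) y k∈))) (y∉ ∘ here ∘ sym) (k , k∈)
          LTz (proj₂ IH Ly (y∉ ∘ there) (k , S∖i⊆S (C ∖ y) z (subst (k ∈ₛ_) (∖-comm C z y) k∈)))

  Maximal : Subset n → Set
  Maximal B = ∀ {w} → w ∉ₛ B → B ⊕ w ∉ V

  Lowering-except? : ∀ B x y → Dec (Lowering B y × y ≢ x)
  Lowering-except? B x y = (y ∈? B ×-dec suc (f (B ∖ y)) ℕₚ.≟ f B) ×-dec ¬? (y Finₚ.≟ x)

  lowering-except : Subset n → Fin n → List (Fin n)
  lowering-except B x = List.filter (Lowering-except? B x) (allFin n)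

  ∈-lowering-except⁻ : ∀ {B x y} → y ∈ lowering-except B x → Lowering B y × y ≢ x
  ∈-lowering-except⁻ {B} {x} y∈ = proj₂ (∈-filter⁻ (Lowering-except? B x) {xs = allFin n} y∈)

  lowering-except-unique : ∀ B x → Unique (lowering-except B x)
  lowering-except-unique B x = Uniqueₚ.filter⁺ (Lowering-except? B x) (Uniqueₚ.allFin⁺ n)

  -- A maximal B has only removals below it, and each of them removes a lowering element.
  maximal-label-bound : ∀ {B} → B ∈ V → Maximal B → 2 ≤ f B → ∀ x → f B ≤ suc (length (lowering-except B x))
  maximal-label-bound {B} B∈V B-maximal fB≥2 x = begin
    f B                                                 ≡⟨ down-degree B B∈V fB≥2 ⟨
    countᵇ (below B) V                                  ≤⟨ countᵇ≤length (below B) (IAR-unique G) below⇒removal ⟩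
    length (List.map (B ∖_) (x ∷ lowering-except B x))  ≡⟨ Listₚ.length-map (B ∖_) (x ∷ lowering-except B x) ⟩
    suc (length (lowering-except B x))                  ∎
    where
    open ℕₚ.≤-Reasoning
    below⇒removal : ∀ {u} → u ∈ V → below B u ≡ true → u ∈ List.map (B ∖_) (x ∷ lowering-except B x)
    below⇒removal {u} u∈V b with ∧≡true⁻ b
    ... | e , level with edge⇒Step B u e
    ... | insert w∉B refl = ⊥-elim (B-maximal w∉B u∈V)
    ... | remove {y} y∈B refl with y Finₚ.≟ x
    ...   | yes refl = here refl
    ...   | no y≢x = there (∈-map⁺ (B ∖_) (∈-filter⁺ (Lowering-except? B x) (∈-allFin y) ((y∈B , Ly) , y≢x)))
      where
      Ly : suc (f (B ∖ y)) ≡ f B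
      Ly = trans (cong suc (≡ᵇ≡true⇒≡ level)) (suc-∸1 (ℕₚ.≤-trans (s≤s z≤n) fB≥2))

  -- Removing every lowering element except x costs one label each, and by the bound above at
  -- least f B - 1 of them exist; what remains has label 1 and is therefore ⁅ x ⁆.
  maximal⇒¬lowering : ∀ {B x} → B ∈ V → Unanchored B → Maximal B → Nonempty (B ∖ x) → ¬ Lowering B x
  maximal⇒¬lowering {B} {x} B∈V B-unanchored B-maximal (j , j∈) (x∈B , Lx) =
    by-cases (Finₚ.any? (λ u → u ∈? C ×-dec ¬? (u Finₚ.≟ x)))
    where
    others : List (Fin n)
    others = lowering-except B x
    x∉others : x ∉ others
    x∉others x∈ = proj₂ (∈-lowering-except⁻ x∈) refl
    C : Subset n
    C = B ∖∗ others
    x∈C : x ∈ₛ C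
    x∈C = ∈-∖∗⁺ others x∉others x∈B
    C∈V : C ∈ V
    C∈V = ⊆-∈IAR G B∈V (∖∗-⊆ B others) x∈C
    descended : f C + length others ≡ f B ×
                (∀ {y} → Lowering B y → y ∉ others → Nonempty (C ∖ y) → Lowering C y)
    descended = descent B∈V (lowering-except-unique B x) (All.tabulate (proj₁ ∘ ∈-lowering-except⁻)) (x , x∈C)
    fB≥2 : 2 ≤ f B
    fB≥2 = subst (2 ≤_) Lx (s≤s (label≥1 (⊆-∈IAR G B∈V (S∖i⊆S B x) j∈)))
    fC≤1 : f C ≤ 1
    fC≤1 = ℕₚ.+-cancelʳ-≤ (length others) (f C) 1
             (subst (_≤ suc (length others)) (sym (proj₁ descended)) (maximal-label-bound B∈V B-maximal fB≥2 x))
    by-cases : Dec (∃ λ u → u ∈ₛ C × u ≢ x) → ⊥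
    by-cases (yes (u , u∈C , u≢x)) = ℕₚ.<⇒≱ (subst (1 <_) (proj₂ LCx) (s≤s (label≥1 (∖-∈V C∈V u≢x u∈C)))) fC≤1
      where
      LCx : Lowering C x
      LCx = proj₂ descended (x∈B , Lx) x∉others (u , ∈-∖⁺ x u≢x u∈C)
    by-cases (no no-other) =
      B-unanchored x∈B (ℕₚ.≤-antisym (subst (λ D → f D ≤ 1) C≡⁅x⁆ fC≤1) (label≥1 (⁅i⁆∈IAR G x)))
      where
      C⊆⁅x⁆ : C ⊆ₛ ⁅ x ⁆
      C⊆⁅x⁆ {u} u∈C with u Finₚ.≟ x
      ... | yes refl = x∈⁅x⁆ u
      ... | no u≢x = ⊥-elim (no-other (u , u∈C , u≢x))
      C≡⁅x⁆ : C ≡ ⁅ x ⁆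
      C≡⁅x⁆ = ⊆-antisym C⊆⁅x⁆ (λ u∈⁅x⁆ → subst (_∈ₛ C) (sym (x∈⁅y⁆⇒x≡y x u∈⁅x⁆)) x∈C)

  Reverses : Subset n → Set
  Reverses B = ∀ {x} → x ∈ₛ B → Nonempty (B ∖ x) → f (B ∖ x) ≡ suc (f B)

  -- If x lowered B, then in an extension B ⊕ w (where x raises, by the hypothesis) the square
  -- through B ⊕ w, B, B ⊕ w ∖ x, B ∖ x would force f (B ∖ x) = f B + 1 as well.
  reverses-step : ∀ {B} → B ∈ V → Unanchored B →
                  (∀ {w} → w ∉ₛ B → B ⊕ w ∈ V → Reverses (B ⊕ w)) → Reverses B
  reverses-step {B} B∈V B-unanchored extensions-reverse {x} x∈B (j , j∈)
    with label-step B∈V (⊆-∈IAR G B∈V (S∖i⊆S B x) j∈) (remove x∈B refl)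
  ... | inj₁ fB∖x≡1+fB = fB∖x≡1+fB
  ... | inj₂ fB≡1+fB∖x = ⊥-elim (by-cases (Finₚ.any? (λ w → ¬? (w ∈? B) ×-dec (B ⊕ w ∈V? V))))
    where
    by-cases : Dec (∃ λ w → w ∉ₛ B × B ⊕ w ∈ V) → ⊥
    by-cases (no maximal) =
      maximal⇒¬lowering B∈V B-unanchored (λ w∉B B′∈V → maximal (_ , w∉B , B′∈V)) (j , j∈) (x∈B , sym fB≡1+fB∖x)
    by-cases (yes (w , w∉B , B′∈V)) = ℕₚ.m≢1+m+n (f (B ⊕ w) + f (B ∖ x)) (begin
      f (B ⊕ w) + f (B ∖ x)             ≡⟨ cong (λ D → f (B ⊕ w) + f D) B′∖x∖w≡B∖x ⟨
      f (B ⊕ w) + f (B ⊕ w ∖ x ∖ w)     ≡⟨ square B′∈V x∈B′ (i∈S⊕i B w) x≢w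
                                             (subst (_∈ V) (sym B′∖x∖w≡B∖x) (⊆-∈IAR G B∈V (S∖i⊆S B x) j∈)) ⟩
      f (B ⊕ w ∖ x) + f (B ⊕ w ∖ w)     ≡⟨ cong₂ _+_ x-raises-B′ (cong f (S⊕i∖i≡S w∉B)) ⟩
      suc (f (B ⊕ w)) + f B             ≡⟨ cong (suc (f (B ⊕ w)) +_) fB≡1+fB∖x ⟩
      suc (f (B ⊕ w)) + suc (f (B ∖ x)) ≡⟨ cong suc (trans (ℕₚ.+-suc (f (B ⊕ w)) (f (B ∖ x))) (ℕₚ.+-comm 1 _)) ⟩
      suc (f (B ⊕ w) + f (B ∖ x) + 1)   ∎)
      where
      open ≡-Reasoning
      x≢w : x ≢ w
      x≢w refl = w∉B x∈B
      x∈B′ : x ∈ₛ B ⊕ w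
      x∈B′ = ∈-⊕⁺ w x∈B
      B′∖x∖w≡B∖x : B ⊕ w ∖ x ∖ w ≡ B ∖ x
      B′∖x∖w≡B∖x = trans (cong (_∖ w) (⊕-∖-comm B x w (x≢w ∘ sym))) (S⊕i∖i≡S (w∉B ∘ S∖i⊆S B x))
      x-raises-B′ : f (B ⊕ w ∖ x) ≡ suc (f (B ⊕ w))
      x-raises-B′ = extensions-reverse w∉B B′∈V x∈B′ (w , ∈-∖⁺ x (x≢w ∘ sym) (i∈S⊕i B w))

  reverses : ∀ k {B} → ∣ B ∣ + k ≡ n → B ∈ V → Unanchored B → Reverses B
  reverses zero {B} ∣B∣+0≡n B∈V B-unanchored = reverses-step B∈V B-unanchored no-room
    where
    no-room : ∀ {w} → w ∉ₛ B → B ⊕ w ∈ V → Reverses (B ⊕ w)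
    no-room {w} w∉B _ = ⊥-elim (ℕₚ.<⇒≱ (subst (_< ∣ B ⊕ w ∣) (trans (sym (ℕₚ.+-identityʳ ∣ B ∣)) ∣B∣+0≡n)
                                          (ℕₚ.≤-reflexive (sym (∣S⊕i∣ B w w∉B)))) (∣p∣≤n (B ⊕ w)))
  reverses (suc k) {B} ∣B∣+1+k≡n B∈V B-unanchored = reverses-step B∈V B-unanchored extension-reverses
    where
    extension-reverses : ∀ {w} → w ∉ₛ B → B ⊕ w ∈ V → Reverses (B ⊕ w)
    extension-reverses {w} w∉B B′∈V =
      reverses k (trans (cong (_+ k) (∣S⊕i∣ B w w∉B)) (trans (sym (ℕₚ.+-suc ∣ B ∣ k)) ∣B∣+1+k≡n)) B′∈V
        (Step-unanchored B∈V B′∈V (insert w∉B refl) B-unanchored)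

  reversal : ∀ {B} → B ∈ V → Unanchored B → Reverses B
  reversal {B} = reverses (n ∸ ∣ B ∣) (ℕₚ.m+[n∸m]≡n (∣p∣≤n B))

  module Component {S₀} (S₀∈V : S₀ ∈ V) (S₀-unanchored : Unanchored S₀) where

    Reachable : Subset n → Set
    Reachable = Reach (IAR G) S₀

    reachable⇒∈V×unanchored : ∀ {T} → Reachable T → T ∈ V × Unanchored T
    reachable⇒∈V×unanchored here = S₀∈V , S₀-unanchored
    reachable⇒∈V×unanchored (step {v} {w} v-reach w∈V e) with reachable⇒∈V×unanchored v-reach
    ... | v∈V , v-unanchored = w∈V , Step-unanchored v∈V w∈V (edge⇒Step v w e) v-unanchored

    reachable⇒∈V : ∀ {T} → Reachable T → T ∈ V
    reachable⇒∈V = proj₁ ∘ reachable⇒∈V×unanchored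

    removal-raises : ∀ {T i} → Reachable T → i ∈ₛ T → T ∖ i ∈ V → f (T ∖ i) ≡ suc (f T)
    removal-raises T-reach i∈T T∖i∈V with reachable⇒∈V×unanchored T-reach
    ... | T∈V , T-unanchored = reversal T∈V T-unanchored i∈T (proj₂ (∈IAR⁻ G T∖i∈V))

    insertion-lowers : ∀ {T w} → Reachable T → w ∉ₛ T → T ⊕ w ∈ V → suc (f (T ⊕ w)) ≡ f T
    insertion-lowers {T} {w} T-reach w∉T T⊕w∈V = begin
      suc (f (T ⊕ w))   ≡⟨ removal-raises (step T-reach T⊕w∈V (Step⇒edge (insert w∉T refl))) (i∈S⊕i T w)
                                            (subst (_∈ V) (sym (S⊕i∖i≡S w∉T)) (reachable⇒∈V T-reach)) ⟨
      f (T ⊕ w ∖ w)     ≡⟨ cong f (S⊕i∖i≡S w∉T) ⟩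
      f T               ∎
      where open ≡-Reasoning

    level : ℕ
    level = f S₀ + ∣ S₀ ∣

    level-invariant : ∀ {T} → Reachable T → f T + ∣ T ∣ ≡ level
    level-invariant here = refl
    level-invariant (step {v} {w} v-reach w∈V e) with edge⇒Step v w e
    ... | remove {i} i∈v refl = begin
      f (v ∖ i) + ∣ v ∖ i ∣       ≡⟨ cong (_+ ∣ v ∖ i ∣) (removal-raises v-reach i∈v w∈V) ⟩
      suc (f v) + ∣ v ∖ i ∣       ≡⟨ ℕₚ.+-suc (f v) ∣ v ∖ i ∣ ⟨
      f v + suc ∣ v ∖ i ∣         ≡⟨ cong (f v +_) (∣S∖i∣ i∈v) ⟩
      f v + ∣ v ∣                 ≡⟨ level-invariant v-reach ⟩
      level                       ∎
      where open ≡-Reasoning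
    ... | insert {i} i∉v refl = begin
      f (v ⊕ i) + ∣ v ⊕ i ∣       ≡⟨ cong (f (v ⊕ i) +_) (∣S⊕i∣ v i i∉v) ⟩
      f (v ⊕ i) + suc ∣ v ∣       ≡⟨ ℕₚ.+-suc (f (v ⊕ i)) ∣ v ∣ ⟩
      suc (f (v ⊕ i)) + ∣ v ∣     ≡⟨ cong (_+ ∣ v ∣) (insertion-lowers v-reach i∉v w∈V) ⟩
      f v + ∣ v ∣                 ≡⟨ level-invariant v-reach ⟩
      level                       ∎
      where open ≡-Reasoning

    below⇒insertion : ∀ {T u} → Reachable T → u ∈ V → below T u ≡ true → ∃ λ w → w ∉ₛ T × u ≡ T ⊕ w
    below⇒insertion {T} {u} T-reach u∈V b with ∧≡true⁻ b
    ... | e , lower with edge⇒Step T u e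
    ... | insert w∉T u≡T⊕w = _ , w∉T , u≡T⊕w
    ... | remove i∈T refl = ⊥-elim (suc≢∸1 (f T) (trans (sym (removal-raises T-reach i∈T u∈V)) (≡ᵇ≡true⇒≡ lower)))

    insertion⇒below : ∀ {T w} → Reachable T → w ∉ₛ T → T ⊕ w ∈ V → below T (T ⊕ w) ≡ true
    insertion⇒below T-reach w∉T T⊕w∈V =
      cong₂ _∧_ (Step⇒edge (insert w∉T refl)) (≡⇒≡ᵇ≡true (cong (_∸ 1) (insertion-lowers T-reach w∉T T⊕w∈V)))

    insert-step : ∀ {T w} → Reachable T → w ∉ₛ T → T ⊕ w ∈ V → Reachable (T ⊕ w)
    insert-step T-reach w∉T T⊕w∈V = step T-reach T⊕w∈V (Step⇒edge (insert w∉T refl))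

    Extension : Subset n → Fin n → Set
    Extension T w = w ∉ₛ T × T ⊕ w ∈ V

    both-extensions : ∀ {U v₁ v₂} → Reachable U → f U ≡ 2 → v₁ ≢ v₂ →
                      (∀ {v} → Extension U v → v ≡ v₁ ⊎ v ≡ v₂) → U ⊕ v₁ ∈ V × U ⊕ v₂ ∈ V
    both-extensions {U} U-reach fU≡2 v₁≢v₂ among
      with countᵇ≡2⇒ (below U) (IAR-unique G)
             (trans (down-degree U (reachable⇒∈V U-reach) (ℕₚ.≤-reflexive (sym fU≡2))) fU≡2)
    ... | z₁ , z₂ , z₁≢z₂ , (z₁∈V , b₁) , (z₂∈V , b₂) , _
      with below⇒insertion U-reach z₁∈V b₁ | below⇒insertion U-reach z₂∈V b₂
    ... | p , p∉U , refl | q , q∉U , refl with among (p∉U , z₁∈V) | among (q∉U , z₂∈V)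
    ... | inj₁ refl | inj₂ refl = z₁∈V , z₂∈V
    ... | inj₂ refl | inj₁ refl = z₂∈V , z₁∈V
    ... | inj₁ refl | inj₁ refl = ⊥-elim (z₁≢z₂ refl)
    ... | inj₂ refl | inj₂ refl = ⊥-elim (z₁≢z₂ refl)

    three-extensions : ∀ {T} → Reachable T → f T ≡ 3 →
                       ∃₂ λ w₁ w₂ → ∃ λ w₃ → w₁ ≢ w₂ × w₁ ≢ w₃ × w₂ ≢ w₃ ×
                         Extension T w₁ × Extension T w₂ × Extension T w₃ ×
                         (∀ {v} → Extension T v → v ≡ w₁ ⊎ v ≡ w₂ ⊎ v ≡ w₃)
    three-extensions {T} T-reach fT≡3
      with countᵇ≡3⇒ (below T) (IAR-unique G)
             (trans (down-degree T (reachable⇒∈V T-reach) (subst (2 ≤_) (sym fT≡3) (s≤s (s≤s z≤n)))) fT≡3)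
    ... | z₁ , z₂ , z₃ , z₁≢z₂ , z₁≢z₃ , z₂≢z₃ , (z₁∈V , b₁) , (z₂∈V , b₂) , (z₃∈V , b₃) , only
      with below⇒insertion T-reach z₁∈V b₁ | below⇒insertion T-reach z₂∈V b₂ | below⇒insertion T-reach z₃∈V b₃
    ... | w₁ , w₁∉T , refl | w₂ , w₂∉T , refl | w₃ , w₃∉T , refl =
      w₁ , w₂ , w₃ , z₁≢z₂ ∘ cong (T ⊕_) , z₁≢z₃ ∘ cong (T ⊕_) , z₂≢z₃ ∘ cong (T ⊕_) ,
      (w₁∉T , z₁∈V) , (w₂∉T , z₂∈V) , (w₃∉T , z₃∈V) , among
      where
      among : ∀ {v} → Extension T v → v ≡ w₁ ⊎ v ≡ w₂ ⊎ v ≡ w₃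
      among (v∉T , T⊕v∈V) =
        Sum.map (⊕-injective v∉T) (Sum.map (⊕-injective v∉T) (⊕-injective v∉T))
          (only T⊕v∈V (insertion⇒below T-reach v∉T T⊕v∈V))

    pairwise-extensions : ∀ {T u v v′} → Reachable T → f T ≡ 3 → Extension T u → v ≢ v′ →
                          (∀ {x} → Extension T x → x ≢ u → x ≡ v ⊎ x ≡ v′) →
                          T ⊕ u ⊕ v ∈ V × T ⊕ u ⊕ v′ ∈ V
    pairwise-extensions {T} {u} {v} {v′} T-reach fT≡3 (u∉T , T⊕u∈V) v≢v′ others =
      both-extensions (insert-step T-reach u∉T T⊕u∈V)
        (ℕₚ.suc-injective (trans (insertion-lowers T-reach u∉T T⊕u∈V) fT≡3)) v≢v′ among
      where
      among : ∀ {x} → Extension (T ⊕ u) x → x ≡ v ⊎ x ≡ v′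
      among {x} (x∉ , T⊕u⊕x∈V) =
        others (x∉ ∘ ∈-⊕⁺ u , ⊆-∈IAR G T⊕u⊕x∈V (⊕-mono (∈-⊕⁺ u) x) (i∈S⊕i T x)) (λ { refl → x∉ (i∈S⊕i T x) })

    -- The three lower neighbours T ⊕ wᵢ of T have the T ⊕ wᵢ ⊕ wⱼ as their lower neighbours, so
    -- T ⊕ w₁ ⊕ w₂ ⊕ w₃ is a vertex, three insertions below T, of label 0.
    no-label-3 : ∀ {T} → Reachable T → f T ≢ 3
    no-label-3 {T} T-reach fT≡3 with three-extensions T-reach fT≡3
    ... | w₁ , w₂ , w₃ , w₁≢w₂ , w₁≢w₃ , w₂≢w₃ , ext₁@(w₁∉T , T⊕w₁∈V) , ext₂ , (w₃∉T , _) , among =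
      ℕₚ.<⇒≢ (label≥1 X∈V) (sym fX≡0)
      where
      T⊕w₁⊕wⱼ∈V : T ⊕ w₁ ⊕ w₂ ∈ V × T ⊕ w₁ ⊕ w₃ ∈ V
      T⊕w₁⊕wⱼ∈V = pairwise-extensions T-reach fT≡3 ext₁ w₂≢w₃ λ x-ext x≢w₁ → [ ⊥-elim ∘ x≢w₁ , id ]′ (among x-ext)
      T⊕w₂⊕wⱼ∈V : T ⊕ w₂ ⊕ w₁ ∈ V × T ⊕ w₂ ⊕ w₃ ∈ V
      T⊕w₂⊕wⱼ∈V = pairwise-extensions T-reach fT≡3 ext₂ w₁≢w₃ λ x-ext x≢w₂ →
                    [ inj₁ , [ ⊥-elim ∘ x≢w₂ , inj₂ ]′ ]′ (among x-ext)
      X : Subset n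
      X = T ⊕ w₁ ⊕ w₂ ⊕ w₃
      X∈V : X ∈ V
      X∈V = ∈IAR⁺ G (triple-independent G (proj₁ (∈IAR⁻ G (proj₁ T⊕w₁⊕wⱼ∈V))) (proj₁ (∈IAR⁻ G (proj₂ T⊕w₁⊕wⱼ∈V)))
                                          (proj₁ (∈IAR⁻ G (proj₂ T⊕w₂⊕wⱼ∈V))))
                    (w₃ , i∈S⊕i _ w₃)
      w₂∉T⊕w₁ : w₂ ∉ₛ T ⊕ w₁
      w₂∉T⊕w₁ = ∉-⊕⁺ w₁ (w₁≢w₂ ∘ sym) (proj₁ ext₂)
      T⊕w₁-reach : Reachable (T ⊕ w₁)
      T⊕w₁-reach = insert-step T-reach w₁∉T T⊕w₁∈V
      fX≡0 : f X ≡ 0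
      fX≡0 = ℕₚ.suc-injective (ℕₚ.suc-injective (ℕₚ.suc-injective (begin
        suc (suc (suc (f X)))         ≡⟨ cong (λ m → suc (suc m))
                                           (insertion-lowers (insert-step T⊕w₁-reach w₂∉T⊕w₁ (proj₁ T⊕w₁⊕wⱼ∈V))
                                             (∉-⊕⁺ w₂ (w₂≢w₃ ∘ sym) (∉-⊕⁺ w₁ (w₁≢w₃ ∘ sym) w₃∉T)) X∈V) ⟩
        suc (suc (f (T ⊕ w₁ ⊕ w₂)))   ≡⟨ cong suc (insertion-lowers T⊕w₁-reach w₂∉T⊕w₁ (proj₁ T⊕w₁⊕wⱼ∈V)) ⟩
        suc (f (T ⊕ w₁))              ≡⟨ insertion-lowers T-reach w₁∉T T⊕w₁∈V ⟩
        f T                           ≡⟨ fT≡3 ⟩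
        3                             ∎)))
        where open ≡-Reasoning

    descend : ∀ k {T} → Reachable T → f T ≡ 3 + k → ∃ λ T′ → Reachable T′ × f T′ ≡ 3
    descend zero T-reach fT≡3 = _ , T-reach , fT≡3
    descend (suc k) {T} T-reach fT≡4+k
      with countᵇ>0⇒satisfied (below T)
             (subst (0 <_) (sym (down-degree T (reachable⇒∈V T-reach) (subst (2 ≤_) (sym fT≡4+k) (s≤s (s≤s z≤n)))))
                           (subst (0 <_) (sym fT≡4+k) (s≤s z≤n)))
    ... | u , u∈V , b = descend k (step T-reach u∈V (proj₁ (∧≡true⁻ b)))
                                  (trans (≡ᵇ≡true⇒≡ (proj₂ (∧≡true⁻ b))) (cong (_∸ 1) fT≡4+k))

    singleton-label : ∀ {a} → Reachable ⁅ a ⁆ → f ⁅ a ⁆ ≡ 2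
    singleton-label {a} a-reach with f ⁅ a ⁆ in fa | label≥1 (reachable⇒∈V a-reach)
    ... | 1 | _ = ⊥-elim (proj₂ (reachable⇒∈V×unanchored a-reach) (x∈⁅x⁆ a) fa)
    ... | 2 | _ = refl
    ... | suc (suc (suc k)) | _ = let T , T-reach , fT≡3 = descend k a-reach fa in ⊥-elim (no-label-3 T-reach fT≡3)

    reachable-singleton : ∀ k {T} → ∣ T ∣ ≡ suc k → Reachable T → ∃ λ a → Reachable ⁅ a ⁆
    reachable-singleton k {T} ∣T∣≡1+k T-reach with proj₂ (∈IAR⁻ G (reachable⇒∈V T-reach))
    reachable-singleton zero ∣T∣≡1 T-reach | a , a∈T = a , subst Reachable (∣S∣≡1⇒S≡⁅i⁆ a∈T ∣T∣≡1) T-reach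
    reachable-singleton (suc k) {T} ∣T∣≡2+k T-reach | a , a∈T
      with another-element a∈T (subst (2 ≤_) (sym ∣T∣≡2+k) (s≤s (s≤s z≤n)))
    ... | b , b≢a , b∈T =
      reachable-singleton k (ℕₚ.suc-injective (trans (∣S∖i∣ b∈T) ∣T∣≡2+k))
        (step T-reach (∖-∈V (reachable⇒∈V T-reach) (b≢a ∘ sym) a∈T) (Step⇒edge (remove b∈T refl)))

    level≡3 : level ≡ 3
    level≡3 = begin
      level               ≡⟨ level-invariant a-reach ⟨
      f ⁅ a ⁆ + ∣ ⁅ a ⁆ ∣ ≡⟨ cong₂ _+_ (singleton-label a-reach) (∣⁅x⁆∣≡1 a) ⟩
      3                   ∎
      where
      open ≡-Reasoning
      a-reach-singleton : ∃ λ a → Reachable ⁅ a ⁆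
      a-reach-singleton =
        reachable-singleton (∣ S₀ ∣ ∸ 1) (sym (suc-∸1 (i∈S⇒∣S∣>0 (proj₂ (proj₂ (∈IAR⁻ G S₀∈V)))))) here
      a : Fin n
      a = proj₁ a-reach-singleton
      a-reach : Reachable ⁅ a ⁆
      a-reach = proj₂ a-reach-singleton

    singleton-neighbours : ∀ {T} → Reachable T → f T ≡ 2 → ∣ T ∣ ≡ 1 → TwoNeighbours (IAR G) T
    singleton-neighbours {T} T-reach fT≡2 ∣T∣≡1
      with countᵇ≡2⇒ (below T) (IAR-unique G)
             (trans (down-degree T (reachable⇒∈V T-reach) (ℕₚ.≤-reflexive (sym fT≡2))) fT≡2)
    ... | z₁ , z₂ , z₁≢z₂ , (z₁∈V , b₁) , (z₂∈V , b₂) , only-below = record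
      { left = z₁ ; right = z₂ ; left≢right = z₁≢z₂ ; left∈X = z₁∈V ; right∈X = z₂∈V
      ; v-left = proj₁ (∧≡true⁻ b₁) ; v-right = proj₁ (∧≡true⁻ b₂)
      ; only = λ u∈V e → only-below u∈V (neighbour-below u∈V e) }
      where
      neighbour-below : ∀ {u} → u ∈ V → E (IAR G) T u ≡ true → below T u ≡ true
      neighbour-below {u} u∈V e with edge⇒Step T u e
      ... | insert w∉T refl = insertion⇒below T-reach w∉T u∈V
      ... | remove i∈T refl =
            ⊥-elim (∣S∣≡0⇒∉ (ℕₚ.suc-injective (trans (∣S∖i∣ i∈T) ∣T∣≡1)) (proj₂ (proj₂ (∈IAR⁻ G u∈V))))

    pair-neighbours : ∀ {T} → Reachable T → f T ≡ 1 → ∣ T ∣ ≡ 2 → TwoNeighbours (IAR G) T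
    pair-neighbours {T} T-reach fT≡1 ∣T∣≡2 with proj₂ (∈IAR⁻ G (reachable⇒∈V T-reach))
    ... | a , a∈T with another-element a∈T (ℕₚ.≤-reflexive (sym ∣T∣≡2))
    ...   | b , b≢a , b∈T = record
      { left = T ∖ a ; right = T ∖ b
      ; left≢right = λ T∖a≡T∖b → i∉S∖i T b (subst (b ∈ₛ_) T∖a≡T∖b (∈-∖⁺ a b≢a b∈T))
      ; left∈X = ∖-∈V (reachable⇒∈V T-reach) b≢a b∈T ; right∈X = ∖-∈V (reachable⇒∈V T-reach) (b≢a ∘ sym) a∈T
      ; v-left = Step⇒edge (remove a∈T refl) ; v-right = Step⇒edge (remove b∈T refl)
      ; only = only }
      where
      only : ∀ {u} → u ∈ V → E (IAR G) T u ≡ true → u ≡ T ∖ a ⊎ u ≡ T ∖ b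
      only {u} u∈V e with edge⇒Step T u e
      ... | insert w∉T refl =
            ⊥-elim (ℕₚ.<⇒≢ (label≥1 u∈V) (sym (ℕₚ.suc-injective (trans (insertion-lowers T-reach w∉T u∈V) fT≡1))))
      ... | remove i∈T refl = Sum.map (cong (T ∖_)) (cong (T ∖_)) (∣S∣≡2⇒pair ∣T∣≡2 a∈T b∈T b≢a i∈T)

    two-neighbours : ∀ {T} → Reachable T → TwoNeighbours (IAR G) T
    two-neighbours {T} T-reach =
      [ uncurry (singleton-neighbours T-reach) , uncurry (pair-neighbours T-reach) ]′
        (split-3 (trans (level-invariant T-reach) level≡3) (label≥1 T∈V) (i∈S⇒∣S∣>0 (proj₂ (proj₂ (∈IAR⁻ G T∈V)))))
      where
      T∈V : T ∈ V
      T∈V = reachable⇒∈V T-reach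

  module _ (no-even-cycle : NoEvenCycleComponent (IAR G)) where

    label≡size : ∀ S → S ∈ V → f S ≡ ∣ S ∣
    label≡size S S∈V with Finₚ.any? (λ a → a ∈? S ×-dec f ⁅ a ⁆ ℕₚ.≟ 1)
    ... | yes (a , a∈S , fa≡1) = Anchored.anchored fa≡1 S∈V a∈S
    ... | no unanchored = ⊥-elim (no-even-cycle S S∈V
            (EvenCycle.componentIsEvenCycle (Vecₚ.≡-dec Boolₚ._≟_) (IAR G) edge-sym ∣_∣
              (λ {u} {v} e → Step-size (edge⇒Step u v e)) S∈V (Component.two-neighbours S∈V S-unanchored)))
      where
      S-unanchored : Unanchored S
      S-unanchored a∈S fa≡1 = unanchored (_ , a∈S , fa≡1)

    layers≡α : p ≡ α G
    layers≡α = ℕₚ.≤-antisym p≤α α≤p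
      where
      p≤α : p ≤ α G
      p≤α with p ℕₚ.≟ 0
      ... | yes p≡0 = subst (_≤ α G) (sym p≡0) z≤n
      ... | no p≢0 with layer-nonempty p (ℕₚ.n≢0⇒n>0 p≢0) ℕₚ.≤-refl
      ...   | S , S∈V , fS≡p =
              subst (_≤ α G) (trans (sym (label≡size S S∈V)) fS≡p) (α-upper G (proj₁ (∈IAR⁻ G S∈V)))
      α≤p : α G ≤ p
      α≤p with α-attained G
      ... | S , S-ind , ∣S∣≡α with nonempty? S
      ...   | yes S-nonempty = subst (_≤ p) (trans (label≡size S S∈V) ∣S∣≡α) (proj₂ (label-range S S∈V))
        where
        S∈V : S ∈ V
        S∈V = ∈IAR⁺ G S-ind S-nonempty
      ...   | no S-empty = subst (_≤ p) ∣S∣≡α (ℕₚ.≤-trans (ℕₚ.≮⇒≥ (S-empty ∘ ∣S∣>0⇒nonempty S)) z≤n)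

lemma4p4 : ∀ {n} (G : SimpleGraph n) → NoEvenCycleComponent (IAR G) →
    IsLayering (IAR G) (α G) ∣_∣ ×
    (∀ (p : ℕ) (f : Subset n → ℕ) → IsLayering (IAR G) p f →
       p ≡ α G × (∀ S → S ∈ verts (IAR G) → f S ≡ ∣ S ∣))
lemma4p4 G no-even-cycle =
  Standard.isLayering G ,
  λ p f L → Layering.layers≡α G L no-even-cycle , Layering.label≡size G L no-even-cycle
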